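{- For every integer $l$, the quantities $\Pr(L^{\square}_{k,m}\le l)$ and $\Pr(L^{\boxminus}_{k,m}\le l)$ are monotone non-increasing in each of $k$ and $m$, and $\Pr(L^{\pm}_{k,m_+,m_- }\le l)$ is monotone non-increasing in each of $k$, $m_+$ and $m_-$.
   Context: $S_{k,m}$: involutions of $\{1,\dots,2k+m\}$ with exactly $m$ fixed points; $L^{\square}_{k,m}$, $L^{\boxminus}_{k,m}$: lengths of the longest increasing, resp. decreasing, subsequence of a uniformly random element of $S_{k,m}$. $S^{\pm}_{k,m_+,m_- }$: bijections $\pi$ of $\{ -N,\dots,-1,1,\dots,N\}$, $N=2k+m_++m_-$, with $\pi(-x)=-\pi(x)$, $\pi=\pi^{ -1}$, exactly $2m_+$ points with $\pi(x)=x$ and $2m_-$ points with $\pi(x)=-x$; $L^{\pm}_{k,m_+,m_- }$: longest increasing subsequence length of the word $\pi(-N),\dots,\pi(-1),\pi(1),\dots,\pi(N)$ for uniform $\pi$. -}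

module Defs where

open import Data.Bool using (Bool; true; false; _∧_; if_then_else_)
open import Data.Nat as ℕ using (ℕ; zero; suc; _+_; _*_; _⊔_; _<?_)
open import Data.Fin using (Fin; toℕ; fromℕ<)
open import Data.Integer as ℤ using (ℤ; +_; -[1+_]; +[1+_]; -_)
open import Data.Rational as ℚ using (ℚ; 0ℚ; _/_)
open import Data.List using (List; []; _∷_; map; length; allFin; upTo; reverse; _++_; cartesianProduct; filterᵇ; foldr)
open import Data.Vec as Vec using (Vec; lookup; toList)
open import Data.Product using (_×_; _,_)
open import Relation.Nullary.Decidable using (⌊_⌋; yes; no)

allVecs : {A : Set} → List A → (k : ℕ) → List (Vec A k)
allVecs xs zero    = Vec.[] ∷ []
allVecs xs (suc k) = Data.List.concatMap (λ x → map (x Vec.∷_) (allVecs xs k)) xs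
  where import Data.List

allᵇ : {A : Set} → (A → Bool) → List A → Bool
allᵇ p = foldr (λ x b → p x ∧ b) true

countᵇ : {A : Set} → (A → Bool) → List A → ℕ
countᵇ p xs = length (filterᵇ p xs)

-- probability that a uniform element of a finite list satisfies p
-- (the empty sample space never occurs below; it is given value 0)
prob : {A : Set} → (A → Bool) → List A → ℚ
prob p xs with length xs
... | zero  = 0ℚ
... | suc n = + countᵇ p xs / suc n

subseqs : {A : Set} → List A → List (List A)
subseqs []       = [] ∷ []
subseqs (x ∷ xs) = subseqs xs ++ map (x ∷_) (subseqs xs)

chainᵇ : (ℤ → ℤ → Bool) → List ℤ → Bool
chainᵇ r []           = true
chainᵇ r (x ∷ [])     = true
chainᵇ r (x ∷ y ∷ ys) = r x y ∧ chainᵇ r (y ∷ ys)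

_<ᵇ_ : ℤ → ℤ → Bool
x <ᵇ y = ⌊ x ℤ.<? y ⌋

_>ᵇ_ : ℤ → ℤ → Bool
x >ᵇ y = ⌊ y ℤ.<? x ⌋

maxList : List ℕ → ℕ
maxList = foldr _⊔_ 0

LIS : List ℤ → ℕ
LIS w = maxList (map length (filterᵇ (chainᵇ _<ᵇ_) (subseqs w)))

LDS : List ℤ → ℕ
LDS w = maxList (map length (filterᵇ (chainᵇ _>ᵇ_) (subseqs w)))

-- Involutions of {1,…,n}: a map π is stored as the vector (π(1),…,π(n)),
-- where the entry i : Fin n stands for the value toℕ i + 1.

isInvolution : {n : ℕ} → Vec (Fin n) n → Bool
isInvolution {n} v = allᵇ (λ i → ⌊ lookup v (lookup v i) Data.Fin.≟ i ⌋) (allFin n)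
  where import Data.Fin

numFixed : {n : ℕ} → Vec (Fin n) n → ℕ
numFixed {n} v = countᵇ (λ i → ⌊ lookup v i Data.Fin.≟ i ⌋) (allFin n)
  where import Data.Fin

S : (k m : ℕ) → List (Vec (Fin (2 * k + m)) (2 * k + m))
S k m = filterᵇ (λ v → isInvolution v ∧ (numFixed v ℕ.≡ᵇ m))
                (allVecs (allFin (2 * k + m)) (2 * k + m))

word : {n : ℕ} → Vec (Fin n) n → List ℤ
word v = map (λ i → + suc (toℕ i)) (toList v)

-- Pr(L^□_{k,m} ≤ l)  and  Pr(L^⊟_{k,m} ≤ l)
PrInc : (k m : ℕ) → ℤ → ℚ
PrInc k m l = prob (λ v → ⌊ + LIS (word v) ℤ.≤? l ⌋) (S k m)

PrDec : (k m : ℕ) → ℤ → ℚ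
PrDec k m l = prob (λ v → ⌊ + LDS (word v) ℤ.≤? l ⌋) (S k m)

-- Signed involutions of {-N,…,-1,1,…,N}.
-- π is stored by its values on 1,…,N: entry (s , i) means
-- π(x) = i+1 if s = false and π(x) = -(i+1) if s = true;
-- it is extended to negative arguments by π(-x) = -π(x).

sval : {N : ℕ} → Bool × Fin N → ℤ
sval (false , i) = + suc (toℕ i)
sval (true  , i) = - (+ suc (toℕ i))

applyS : {N : ℕ} → Vec (Bool × Fin N) N → ℤ → ℤ
applyS v (+ zero) = + 0
applyS {N} v +[1+ n ] with n <? N
... | yes p = sval (lookup v (fromℕ< p))
... | no _  = + 0
applyS v -[1+ n ] = - applyS v +[1+ n ]

domain : ℕ → List ℤ
domain N = map -[1+_] (reverse (upTo N)) ++ map +[1+_] (upTo N)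

_==ℤ_ : ℤ → ℤ → Bool
x ==ℤ y = ⌊ x ℤ.≟ y ⌋

isSignedInvolution : {N : ℕ} → Vec (Bool × Fin N) N → Bool
isSignedInvolution {N} v = allᵇ (λ x → applyS v (applyS v x) ==ℤ x) (domain N)

numFixedS : {N : ℕ} → Vec (Bool × Fin N) N → ℕ
numFixedS {N} v = countᵇ (λ x → applyS v x ==ℤ x) (domain N)

numNegS : {N : ℕ} → Vec (Bool × Fin N) N → ℕ
numNegS {N} v = countᵇ (λ x → applyS v x ==ℤ (- x)) (domain N)

sizeS : (k m₊ m₋ : ℕ) → ℕ
sizeS k m₊ m₋ = 2 * k + m₊ + m₋

S± : (k m₊ m₋ : ℕ) → List (Vec (Bool × Fin (sizeS k m₊ m₋)) (sizeS k m₊ m₋))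
S± k m₊ m₋ =
  filterᵇ (λ v → isSignedInvolution v ∧ (numFixedS v ℕ.≡ᵇ 2 * m₊) ∧ (numNegS v ℕ.≡ᵇ 2 * m₋))
          (allVecs (cartesianProduct (false ∷ true ∷ []) (allFin (sizeS k m₊ m₋))) (sizeS k m₊ m₋))

wordS : {N : ℕ} → Vec (Bool × Fin N) N → List ℤ
wordS {N} v = map (applyS v) (domain N)

PrSigned : (k m₊ m₋ : ℕ) → ℤ → ℚ
PrSigned k m₊ m₋ l = prob (λ v → ⌊ + LIS (wordS v) ℤ.≤? l ⌋) (S± k m₊ m₋)

{-# OPTIONS --safe #-}
module Submission where

-- Deleting a fixed point or a 2-cycle from an involution cannot lengthen a longest monotone
-- subsequence: after an order-preserving relabelling of the values, the word of the smaller
-- involution is a subsequence of the word of the larger one.  Conversely, inserting a fixed point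
-- or a 2-cycle maps a class A of involutions into the next class B, and every π ∈ B arises from
-- the same number d+1 of pairs (σ ∈ A, insertion site): one per fixed point of π, resp. one per
-- non-fixed position of π.  Counting the pairs with L (insert σ c) ≤ l in two ways gives
-- (d+1) #{π ∈ B : L π ≤ l} ≤ #sites #{σ ∈ A : L σ ≤ l}, and counting all pairs gives
-- (d+1) #B = #sites #A; dividing, Pr_B (L ≤ l) ≤ Pr_A (L ≤ l).  Signed involutions are treated
-- in the same way with points labelled by a sign; monotonicity in each parameter follows by
-- iterating these one-step inequalities.

open import Algebra.Properties.CommutativeSemigroup using (interchange; x∙yz≈y∙xz)
open import Data.Bool using (Bool; true; false; T; _∧_; not)
open import Data.Bool.Properties using (T-∧; T-≡; not-involutive)
import Data.Bool.Properties as Bool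
open import Data.Fin as Fin using (Fin; zero; suc; punchIn; punchOut; toℕ)
open import Data.Fin.Properties
  using (punchInᵢ≢i; punchIn-injective; punchIn-punchOut; punchIn-mono-≤; punchIn-cancel-≤; fromℕ<-toℕ; toℕ<n; toℕ-injective)
open import Data.Integer as ℤ using (ℤ; -[1+_]; +[1+_])
import Data.Integer.Properties as ℤ
open import Data.List as List
  using (List; []; _∷_; map; length; _++_; filterᵇ; concatMap; cartesianProduct; reverse; tabulate; allFin; upTo; applyUpTo)
import Data.List.Properties as List
open import Data.List.Membership.Propositional using (_∈_)
open import Data.List.Membership.Propositional.Properties using (∈-map⁺; ∈-map⁻; ∈-++⁺ˡ; ∈-++⁺ʳ; ∈-++⁻; ∈-allFin)
open import Data.List.Relation.Binary.Sublist.Propositional using (_⊆_; []; _∷_; _∷ʳ_; ⊆-refl; ⊆-trans)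
open import Data.List.Relation.Binary.Sublist.Propositional.Properties using (map⁺; ++⁺; reverse⁺)
open import Data.List.Relation.Unary.Any using (here; there)
import Data.List.Relation.Unary.Any.Properties as Any
open import Data.Nat as ℕ using (ℕ; zero; suc; _+_; _*_; _≤_; z≤n; _≤′_; ≤′-refl; ≤′-step)
open import Data.Nat.Properties
  using (+-mono-≤; +-assoc; +-comm; +-identityʳ; +-cancelˡ-≡; *-zeroʳ; *-identityʳ; *-distribˡ-+; *-cancelˡ-≤; *-assoc;
         *-monoˡ-≤; *-comm; ≤-refl; ≤-trans; m≤m⊔n; m≤n⊔m; ⊔-lub; +-commutativeSemigroup; module ≤-Reasoning)
import Data.Nat.Properties as ℕ
open import Data.Product using (Σ; _×_; _,_; proj₁; proj₂)
import Data.Product.Properties as Product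
open import Data.Rational as ℚ using (ℚ; _/_) renaming (_≤_ to _≤ℚ_)
import Data.Rational.Properties as ℚ
open import Data.Rational.Unnormalised as ℚᵘ using (mkℚᵘ; *≤*)
import Data.Rational.Unnormalised.Properties as ℚᵘ
open import Data.Sum using (inj₁; inj₂)
open import Data.Unit using (⊤; tt)
import Data.Unit.Properties as Unit
open import Data.Vec as Vec using (Vec; lookup; insertAt; toList)
open import Data.Vec.Properties using (insertAt-lookup; insertAt-punchIn; lookup-map; lookup∘tabulate; tabulate∘lookup)
import Data.Vec.Properties as Vec
open import Function using (_∘_; _⇔_; mk⇔; Equivalence)
open import Relation.Binary.Definitions using (DecidableEquality)
open import Relation.Binary.PropositionalEquality
open import Relation.Nullary using (Dec; yes; no; ¬_; contradiction)
open import Relation.Nullary.Decidable using (⌊_⌋; toWitness; fromWitness)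
open import Defs

private
  variable
    A B : Set
    P Q R : Set
    k m n : ℕ

⟦_⟧ : Bool → ℕ
⟦ true ⟧  = 1
⟦ false ⟧ = 0

𝟙 : Dec P → ℕ
𝟙 d = ⟦ ⌊ d ⌋ ⟧

𝟙-yes : (d : Dec P) → P → 𝟙 d ≡ 1
𝟙-yes (yes _) _ = refl
𝟙-yes (no ¬p) p = contradiction p ¬p

𝟙-no : (d : Dec P) → ¬ P → 𝟙 d ≡ 0
𝟙-no (yes p) ¬p = contradiction p ¬p
𝟙-no (no _)  _  = refl

⌊⌋-cong : (d : Dec P) (e : Dec Q) → (P → Q) → (Q → P) → ⌊ d ⌋ ≡ ⌊ e ⌋
⌊⌋-cong (yes p) (yes q) f g = refl
⌊⌋-cong (yes p) (no ¬q) f g = contradiction (f p) ¬q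
⌊⌋-cong (no ¬p) (yes q) f g = contradiction (g q) ¬p
⌊⌋-cong (no ¬p) (no ¬q) f g = refl

𝟙-cong : (d : Dec P) (e : Dec Q) → (P → Q) → (Q → P) → 𝟙 d ≡ 𝟙 e
𝟙-cong d e f g = cong ⟦_⟧ (⌊⌋-cong d e f g)

𝟙-× : (d : Dec P) (e : Dec Q) (r : Dec R) → (R → P × Q) → (P → Q → R) → 𝟙 r ≡ 𝟙 d * 𝟙 e
𝟙-× (yes p) (yes q) r f g = 𝟙-yes r (g p q)
𝟙-× (yes p) (no ¬q) r f g = 𝟙-no r (¬q ∘ proj₂ ∘ f)
𝟙-× (no ¬p) e       r f g = 𝟙-no r (¬p ∘ proj₁ ∘ f)

∑ : List A → (A → ℕ) → ℕ
∑ []       f = 0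
∑ (x ∷ xs) f = f x + ∑ xs f

syntax ∑ xs (λ x → e) = ∑[ x ∈ xs ] e

module _ {f g : A → ℕ} where

  ∑-cong : (xs : List A) → (∀ x → f x ≡ g x) → ∑ xs f ≡ ∑ xs g
  ∑-cong []       f≗g = refl
  ∑-cong (x ∷ xs) f≗g = cong₂ _+_ (f≗g x) (∑-cong xs f≗g)

  ∑-mono-≤ : (xs : List A) → (∀ x → f x ≤ g x) → ∑ xs f ≤ ∑ xs g
  ∑-mono-≤ []       f≤g = z≤n
  ∑-mono-≤ (x ∷ xs) f≤g = +-mono-≤ (f≤g x) (∑-mono-≤ xs f≤g)

  ∑-+ : (xs : List A) → ∑[ x ∈ xs ] (f x + g x) ≡ ∑ xs f + ∑ xs g
  ∑-+ []       = refl
  ∑-+ (x ∷ xs) = trans (cong (f x + g x +_) (∑-+ xs))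
                       (interchange +-commutativeSemigroup (f x) (g x) (∑ xs f) (∑ xs g))

∑-*ˡ : (xs : List A) (k : ℕ) (f : A → ℕ) → ∑[ x ∈ xs ] (k * f x) ≡ k * ∑ xs f
∑-*ˡ []       k f = sym (*-zeroʳ k)
∑-*ˡ (x ∷ xs) k f = trans (cong (k * f x +_) (∑-*ˡ xs k f)) (sym (*-distribˡ-+ k (f x) _))

∑-const : (xs : List A) (k : ℕ) → ∑[ x ∈ xs ] k ≡ length xs * k
∑-const []       k = refl
∑-const (x ∷ xs) k = cong (k +_) (∑-const xs k)

∑-zero : (xs : List A) → ∑[ x ∈ xs ] 0 ≡ 0
∑-zero xs = trans (∑-const xs 0) (*-zeroʳ (length xs))

length≡∑ : (xs : List A) → length xs ≡ ∑[ x ∈ xs ] 1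
length≡∑ xs = sym (trans (∑-const xs 1) (*-identityʳ (length xs)))

∑-++ : (xs ys : List A) (f : A → ℕ) → ∑ (xs ++ ys) f ≡ ∑ xs f + ∑ ys f
∑-++ []       ys f = refl
∑-++ (x ∷ xs) ys f = trans (cong (f x +_) (∑-++ xs ys f)) (sym (+-assoc (f x) _ _))

∑-map : (g : A → B) (xs : List A) (f : B → ℕ) → ∑ (map g xs) f ≡ ∑ xs (f ∘ g)
∑-map g []       f = refl
∑-map g (x ∷ xs) f = cong (f (g x) +_) (∑-map g xs f)

∑-reverse : (xs : List A) (f : A → ℕ) → ∑ (reverse xs) f ≡ ∑ xs f
∑-reverse []       f = refl
∑-reverse (x ∷ xs) f = begin
  ∑ (reverse (x ∷ xs)) f        ≡⟨ cong (λ ys → ∑ ys f) (List.unfold-reverse x xs) ⟩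
  ∑ (reverse xs ++ x ∷ []) f    ≡⟨ ∑-++ (reverse xs) (x ∷ []) f ⟩
  ∑ (reverse xs) f + (f x + 0)  ≡⟨ cong₂ _+_ (∑-reverse xs f) (+-identityʳ (f x)) ⟩
  ∑ xs f + f x                  ≡⟨ +-comm _ (f x) ⟩
  f x + ∑ xs f                  ∎
  where open ≡-Reasoning

∑-comm : (xs : List A) (ys : List B) (f : A → B → ℕ) →
         ∑[ x ∈ xs ] ∑ ys (f x) ≡ ∑[ y ∈ ys ] ∑[ x ∈ xs ] f x y
∑-comm []       ys f = sym (∑-zero ys)
∑-comm (x ∷ xs) ys f = trans (cong (∑ ys (f x) +_) (∑-comm xs ys f)) (sym (∑-+ ys))

∑-concatMap : (g : A → List B) (xs : List A) (f : B → ℕ) → ∑ (concatMap g xs) f ≡ ∑[ x ∈ xs ] ∑ (g x) f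
∑-concatMap g []       f = refl
∑-concatMap g (x ∷ xs) f = trans (∑-++ (g x) (concatMap g xs) f) (cong (∑ (g x) f +_) (∑-concatMap g xs f))

∑-cartesianProduct : (xs : List A) (ys : List B) (f : A × B → ℕ) →
                     ∑ (cartesianProduct xs ys) f ≡ ∑[ x ∈ xs ] ∑[ y ∈ ys ] f (x , y)
∑-cartesianProduct []       ys f = refl
∑-cartesianProduct (x ∷ xs) ys f =
  trans (∑-++ (map (x ,_) ys) _ f) (cong₂ _+_ (∑-map (x ,_) ys f) (∑-cartesianProduct xs ys f))

∑-filterᵇ : (p : A → Bool) (xs : List A) (f : A → ℕ) → ∑ (filterᵇ p xs) f ≡ ∑[ x ∈ xs ] (⟦ p x ⟧ * f x)
∑-filterᵇ p []       f = refl
∑-filterᵇ p (x ∷ xs) f with p x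
... | true  = cong₂ _+_ (sym (+-identityʳ (f x))) (∑-filterᵇ p xs f)
... | false = ∑-filterᵇ p xs f

countᵇ≡∑ : (p : A → Bool) (xs : List A) → countᵇ p xs ≡ ∑[ x ∈ xs ] ⟦ p x ⟧
countᵇ≡∑ p xs = begin
  length (filterᵇ p xs)         ≡⟨ length≡∑ (filterᵇ p xs) ⟩
  ∑[ x ∈ filterᵇ p xs ] 1       ≡⟨ ∑-filterᵇ p xs _ ⟩
  ∑[ x ∈ xs ] (⟦ p x ⟧ * 1)     ≡⟨ ∑-cong xs (λ x → *-identityʳ ⟦ p x ⟧) ⟩
  ∑[ x ∈ xs ] ⟦ p x ⟧           ∎
  where open ≡-Reasoning

∑-tabulate : ∀ {n} (g : Fin n → A) (f : A → ℕ) → ∑ (tabulate g) f ≡ ∑ (allFin n) (f ∘ g)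
∑-tabulate {n = zero}  g f = refl
∑-tabulate {n = suc n} g f =
  cong (f (g zero) +_) (trans (∑-tabulate (g ∘ suc) f) (sym (∑-tabulate suc (f ∘ g))))

∑-allFin-punchIn : ∀ {n} (a : Fin (suc n)) (f : Fin (suc n) → ℕ) →
                   ∑ (allFin (suc n)) f ≡ f a + ∑ (allFin n) (f ∘ punchIn a)
∑-allFin-punchIn zero f = cong (f zero +_) (∑-tabulate suc f)
∑-allFin-punchIn {suc n} (suc a) f = begin
  f zero + ∑ (tabulate suc) f                                          ≡⟨ cong (f zero +_) (∑-tabulate suc f) ⟩
  f zero + ∑ (allFin (suc n)) (f ∘ suc)                                ≡⟨ cong (f zero +_) (∑-allFin-punchIn a (f ∘ suc)) ⟩
  f zero + (f (suc a) + ∑ (allFin n) (f ∘ suc ∘ punchIn a))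
    ≡⟨ x∙yz≈y∙xz +-commutativeSemigroup (f zero) (f (suc a)) _ ⟩
  f (suc a) + (f zero + ∑ (allFin n) (f ∘ suc ∘ punchIn a))
    ≡⟨ cong (λ s → f (suc a) + (f zero + s)) (∑-tabulate suc (f ∘ punchIn (suc a))) ⟨
  f (suc a) + ∑ (allFin (suc n)) (f ∘ punchIn (suc a))                 ∎
  where open ≡-Reasoning

record Enumerates (_≟_ : DecidableEquality A) (xs : List A) : Set where
  field
    occurs-once : ∀ z → ∑[ x ∈ xs ] 𝟙 (x ≟ z) ≡ 1

open Enumerates public

allFin-enumerates : ∀ n → Enumerates Fin._≟_ (allFin n)
allFin-enumerates zero    .occurs-once ()
allFin-enumerates (suc n) .occurs-once z = begin
  ∑[ x ∈ allFin (suc n) ] 𝟙 (x Fin.≟ z)                  ≡⟨ ∑-allFin-punchIn z _ ⟩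
  𝟙 (z Fin.≟ z) + ∑[ y ∈ allFin n ] 𝟙 (punchIn z y Fin.≟ z)
    ≡⟨ cong₂ _+_ (𝟙-yes (z Fin.≟ z) refl) (∑-cong (allFin n) (λ y → 𝟙-no (punchIn z y Fin.≟ z) (punchInᵢ≢i z y))) ⟩
  1 + ∑[ y ∈ allFin n ] 0                                 ≡⟨ cong suc (∑-zero (allFin n)) ⟩
  1                                                       ∎
  where open ≡-Reasoning

module _ {_≟A_ : DecidableEquality A} {_≟B_ : DecidableEquality B} where

  cartesianProduct-enumerates : ∀ {xs ys} → Enumerates _≟A_ xs → Enumerates _≟B_ ys →
                                Enumerates (Product.≡-dec _≟A_ _≟B_) (cartesianProduct xs ys)
  cartesianProduct-enumerates {xs} {ys} xs-enum ys-enum .occurs-once (z , w) = begin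
    ∑[ p ∈ cartesianProduct xs ys ] 𝟙 (p ≟ (z , w))           ≡⟨ ∑-cartesianProduct xs ys _ ⟩
    ∑[ x ∈ xs ] ∑[ y ∈ ys ] 𝟙 ((x , y) ≟ (z , w))
      ≡⟨ ∑-cong xs (λ x → ∑-cong ys (λ y →
           𝟙-× (x ≟A z) (y ≟B w) ((x , y) ≟ (z , w)) Product.,-injective (cong₂ _,_))) ⟩
    ∑[ x ∈ xs ] ∑[ y ∈ ys ] (𝟙 (x ≟A z) * 𝟙 (y ≟B w))
      ≡⟨ ∑-cong xs (λ x → trans (∑-*ˡ ys (𝟙 (x ≟A z)) _)
           (trans (cong (𝟙 (x ≟A z) *_) (occurs-once ys-enum w)) (*-identityʳ _))) ⟩
    ∑[ x ∈ xs ] 𝟙 (x ≟A z)                                     ≡⟨ occurs-once xs-enum z ⟩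
    1                                                           ∎
    where
    open ≡-Reasoning
    _≟_ = Product.≡-dec _≟A_ _≟B_

module _ {_≟_ : DecidableEquality A} where

  allVecs-enumerates : ∀ {xs} → Enumerates _≟_ xs → ∀ k → Enumerates (Vec.≡-dec _≟_) (allVecs xs k)
  allVecs-enumerates xs-enum zero    .occurs-once Vec.[] = refl
  allVecs-enumerates {xs} xs-enum (suc k) .occurs-once (z Vec.∷ zs) = begin
    ∑[ v ∈ allVecs xs (suc k) ] 𝟙 (v ≟ᵛ (z Vec.∷ zs))
      ≡⟨ ∑-concatMap _ xs _ ⟩
    ∑[ x ∈ xs ] ∑[ v ∈ map (x Vec.∷_) (allVecs xs k) ] 𝟙 (v ≟ᵛ (z Vec.∷ zs))
      ≡⟨ ∑-cong xs (λ x → ∑-map (x Vec.∷_) (allVecs xs k) _) ⟩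
    ∑[ x ∈ xs ] ∑[ w ∈ allVecs xs k ] 𝟙 ((x Vec.∷ w) ≟ᵛ (z Vec.∷ zs))
      ≡⟨ ∑-cong xs (λ x → ∑-cong (allVecs xs k) (λ w →
           𝟙-× (x ≟ z) (w ≟ᵛ zs) ((x Vec.∷ w) ≟ᵛ (z Vec.∷ zs))
               (λ e → Vec.∷-injectiveˡ e , Vec.∷-injectiveʳ e) (cong₂ Vec._∷_))) ⟩
    ∑[ x ∈ xs ] ∑[ w ∈ allVecs xs k ] (𝟙 (x ≟ z) * 𝟙 (w ≟ᵛ zs))
      ≡⟨ ∑-cong xs (λ x → trans (∑-*ˡ (allVecs xs k) (𝟙 (x ≟ z)) _)
           (trans (cong (𝟙 (x ≟ z) *_) (occurs-once (allVecs-enumerates xs-enum k) zs)) (*-identityʳ _))) ⟩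
    ∑[ x ∈ xs ] 𝟙 (x ≟ z)
      ≡⟨ occurs-once xs-enum z ⟩
    1 ∎
    where
    open ≡-Reasoning
    _≟ᵛ_ : ∀ {k} → DecidableEquality (Vec A k)
    _≟ᵛ_ = Vec.≡-dec _≟_

record RegularInsertion {V W C : Set} (inA : V → Bool) (inB : W → Bool) (sites : List C) (d : ℕ) : Set where
  field
    insert            : V → C → W
    IsSite            : W → C → Bool
    insert-∈          : ∀ {σ} c → T (inA σ) → T (inB (insert σ c))
    insert-isSite     : ∀ {σ} c → T (inA σ) → T (IsSite (insert σ c) c)
    insert-injective  : ∀ {σ σ′} c → T (inA σ) → T (inA σ′) → insert σ c ≡ insert σ′ c → σ ≡ σ′
    insert-surjective : ∀ {π} c → T (inB π) → T (IsSite π c) → Σ V (λ σ → T (inA σ) × insert σ c ≡ π)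
    sites-count       : ∀ {π} → T (inB π) → ∑[ c ∈ sites ] ⟦ IsSite π c ⟧ ≡ suc d

cross-multiply-≤ : ∀ d c a b x y → suc d * b ≤ c * a → suc d * y ≡ c * x → b * x ≤ a * y
cross-multiply-≤ d c a b x y db≤ca dy≡cx = *-cancelˡ-≤ (suc d) (begin
  suc d * (b * x)    ≡⟨ *-assoc (suc d) b x ⟨
  suc d * b * x      ≤⟨ *-monoˡ-≤ x db≤ca ⟩
  c * a * x          ≡⟨ cong (_* x) (*-comm c a) ⟩
  a * c * x          ≡⟨ *-assoc a c x ⟩
  a * (c * x)        ≡⟨ cong (a *_) dy≡cx ⟨
  a * (suc d * y)    ≡⟨ x∙yz≈y∙xz ℕ.*-commutativeSemigroup a (suc d) y ⟩
  suc d * (a * y)    ∎)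
  where open ≤-Reasoning

cross-≤⇒/-≤ : ∀ b m a n → b * suc n ≤ a * suc m → ℤ.+ b / suc m ≤ℚ ℤ.+ a / suc n
cross-≤⇒/-≤ b m a n le = ℚ.toℚᵘ-cancel-≤
  (ℚᵘ.≤-respˡ-≃ (ℚᵘ.≃-sym (ℚ.toℚᵘ-fromℚᵘ (mkℚᵘ (ℤ.+ b) m)))
    (ℚᵘ.≤-respʳ-≃ (ℚᵘ.≃-sym (ℚ.toℚᵘ-fromℚᵘ (mkℚᵘ (ℤ.+ a) n)))
      (*≤* (subst₂ ℤ._≤_ (ℤ.pos-* b (suc n)) (ℤ.pos-* a (suc m)) (ℤ.+≤+ le)))))

prob-≤ : (p : A → Bool) (xs : List A) (q : B → Bool) (ys : List B) (c d : ℕ) →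
         suc d * countᵇ q ys ≤ c * countᵇ p xs → suc d * length ys ≡ c * length xs →
         prob q ys ≤ℚ prob p xs
prob-≤ p xs q ys c d counts sizes with length ys | length xs
... | zero   | zero  = ℚ.≤-refl
... | zero   | suc n = ℚ.nonNegative⁻¹ _ {{ℚ.normalize-nonNeg (countᵇ p xs) (suc n)}}
... | suc m  | zero  = contradiction (trans sizes (*-zeroʳ c)) (λ ())
... | suc m  | suc n = cross-≤⇒/-≤ (countᵇ q ys) m (countᵇ p xs) n
                         (cross-multiply-≤ d c (countᵇ p xs) (countᵇ q ys) (suc n) (suc m) counts sizes)

module _ {V W C : Set} {_≟V_ : DecidableEquality V} {_≟W_ : DecidableEquality W}
         {EA : List V} {EB : List W} (EA-enum : Enumerates _≟V_ EA) (EB-enum : Enumerates _≟W_ EB)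
         {inA : V → Bool} {inB : W → Bool} {sites : List C} {d : ℕ} (I : RegularInsertion inA inB sites d) where

  open RegularInsertion I

  private
    T-of : ∀ {b} → b ≡ true → T b
    T-of = Equivalence.from T-≡

  fibre-size : ∀ π c → ∑[ σ ∈ EA ] (⟦ inA σ ⟧ * 𝟙 (π ≟W insert σ c)) ≡ ⟦ inB π ⟧ * ⟦ IsSite π c ⟧
  fibre-size π c with inB π in π∈ | IsSite π c in site
  ... | true  | true  = trans (∑-cong EA term) (occurs-once EA-enum σ₀)
    where
    σ₀-∈-↦ = insert-surjective c (T-of π∈) (T-of site)
    σ₀      = proj₁ σ₀-∈-↦
    σ₀∈     = proj₁ (proj₂ σ₀-∈-↦)
    σ₀↦π    = proj₂ (proj₂ σ₀-∈-↦)
    term : ∀ σ → ⟦ inA σ ⟧ * 𝟙 (π ≟W insert σ c) ≡ 𝟙 (σ ≟V σ₀)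
    term σ with inA σ in σ∈
    ... | false = sym (𝟙-no (σ ≟V σ₀) (λ { refl → subst T σ∈ σ₀∈ }))
    ... | true  = trans (+-identityʳ _) (𝟙-cong (π ≟W insert σ c) (σ ≟V σ₀)
                    (λ π≡ → insert-injective c (T-of σ∈) σ₀∈ (trans (sym π≡) (sym σ₀↦π)))
                    (λ { refl → sym σ₀↦π }))
  ... | true  | false = trans (∑-cong EA term) (∑-zero EA)
    where
    term : ∀ σ → ⟦ inA σ ⟧ * 𝟙 (π ≟W insert σ c) ≡ 0
    term σ with inA σ in σ∈
    ... | false = refl
    ... | true  = trans (+-identityʳ _) (𝟙-no (π ≟W insert σ c)
                    (λ { refl → subst T site (insert-isSite c (T-of σ∈)) }))
  ... | false | _     = trans (∑-cong EA term) (∑-zero EA)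
    where
    term : ∀ σ → ⟦ inA σ ⟧ * 𝟙 (π ≟W insert σ c) ≡ 0
    term σ with inA σ in σ∈
    ... | false = refl
    ... | true  = trans (+-identityʳ _) (𝟙-no (π ≟W insert σ c)
                    (λ { refl → subst T π∈ (insert-∈ c (T-of σ∈)) }))

  count-insertions-at : ∀ c (Q : W → Bool) →
    ∑[ σ ∈ EA ] (⟦ inA σ ⟧ * ⟦ Q (insert σ c) ⟧) ≡ ∑[ π ∈ EB ] (⟦ Q π ⟧ * (⟦ inB π ⟧ * ⟦ IsSite π c ⟧))
  count-insertions-at c Q = begin
    ∑[ σ ∈ EA ] (⟦ inA σ ⟧ * ⟦ Q (insert σ c) ⟧)
      ≡⟨ ∑-cong EA (λ σ → trans (cong (⟦ inA σ ⟧ * ⟦ Q (insert σ c) ⟧ *_) (occurs-once EB-enum (insert σ c)))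
                                (*-identityʳ _)) ⟨
    ∑[ σ ∈ EA ] (⟦ inA σ ⟧ * ⟦ Q (insert σ c) ⟧ * ∑[ π ∈ EB ] 𝟙 (π ≟W insert σ c))
      ≡⟨ ∑-cong EA (λ σ → ∑-*ˡ EB (⟦ inA σ ⟧ * ⟦ Q (insert σ c) ⟧) (λ π → 𝟙 (π ≟W insert σ c))) ⟨
    ∑[ σ ∈ EA ] ∑[ π ∈ EB ] (⟦ inA σ ⟧ * ⟦ Q (insert σ c) ⟧ * 𝟙 (π ≟W insert σ c))
      ≡⟨ ∑-cong EA (λ σ → ∑-cong EB (λ π → move-Q σ π)) ⟩
    ∑[ σ ∈ EA ] ∑[ π ∈ EB ] (⟦ Q π ⟧ * (⟦ inA σ ⟧ * 𝟙 (π ≟W insert σ c)))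
      ≡⟨ ∑-comm EA EB _ ⟩
    ∑[ π ∈ EB ] ∑[ σ ∈ EA ] (⟦ Q π ⟧ * (⟦ inA σ ⟧ * 𝟙 (π ≟W insert σ c)))
      ≡⟨ ∑-cong EB (λ π → trans (∑-*ˡ EA ⟦ Q π ⟧ _) (cong (⟦ Q π ⟧ *_) (fibre-size π c))) ⟩
    ∑[ π ∈ EB ] (⟦ Q π ⟧ * (⟦ inB π ⟧ * ⟦ IsSite π c ⟧))
      ∎
    where
    open ≡-Reasoning
    move-Q : ∀ σ π → ⟦ inA σ ⟧ * ⟦ Q (insert σ c) ⟧ * 𝟙 (π ≟W insert σ c) ≡
                     ⟦ Q π ⟧ * (⟦ inA σ ⟧ * 𝟙 (π ≟W insert σ c))
    move-Q σ π with π ≟W insert σ c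
    ... | yes refl = trans (*-identityʳ _) (trans (*-comm ⟦ inA σ ⟧ _) (cong (⟦ Q π ⟧ *_) (sym (*-identityʳ _))))
    ... | no _     = trans (*-zeroʳ (⟦ inA σ ⟧ * ⟦ Q (insert σ c) ⟧))
                           (sym (trans (cong (⟦ Q π ⟧ *_) (*-zeroʳ ⟦ inA σ ⟧)) (*-zeroʳ ⟦ Q π ⟧)))

  count-insertions : (Q : W → Bool) →
    ∑[ c ∈ sites ] ∑[ σ ∈ EA ] (⟦ inA σ ⟧ * ⟦ Q (insert σ c) ⟧) ≡ suc d * ∑[ π ∈ EB ] (⟦ inB π ⟧ * ⟦ Q π ⟧)
  count-insertions Q = begin
    ∑[ c ∈ sites ] ∑[ σ ∈ EA ] (⟦ inA σ ⟧ * ⟦ Q (insert σ c) ⟧)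
      ≡⟨ ∑-cong sites (λ c → count-insertions-at c Q) ⟩
    ∑[ c ∈ sites ] ∑[ π ∈ EB ] (⟦ Q π ⟧ * (⟦ inB π ⟧ * ⟦ IsSite π c ⟧))
      ≡⟨ ∑-comm sites EB _ ⟩
    ∑[ π ∈ EB ] ∑[ c ∈ sites ] (⟦ Q π ⟧ * (⟦ inB π ⟧ * ⟦ IsSite π c ⟧))
      ≡⟨ ∑-cong EB count-sites ⟩
    ∑[ π ∈ EB ] (suc d * (⟦ inB π ⟧ * ⟦ Q π ⟧))
      ≡⟨ ∑-*ˡ EB (suc d) _ ⟩
    suc d * ∑[ π ∈ EB ] (⟦ inB π ⟧ * ⟦ Q π ⟧)
      ∎
    where
    open ≡-Reasoning
    count-sites : ∀ π → ∑[ c ∈ sites ] (⟦ Q π ⟧ * (⟦ inB π ⟧ * ⟦ IsSite π c ⟧)) ≡ suc d * (⟦ inB π ⟧ * ⟦ Q π ⟧)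
    count-sites π with inB π in π∈
    ... | false = trans (∑-cong sites (λ c → *-zeroʳ ⟦ Q π ⟧)) (trans (∑-zero sites) (sym (*-zeroʳ (suc d))))
    ... | true  = begin
      ∑[ c ∈ sites ] (⟦ Q π ⟧ * (⟦ IsSite π c ⟧ + 0)) ≡⟨ ∑-cong sites (λ c → cong (⟦ Q π ⟧ *_) (+-identityʳ _)) ⟩
      ∑[ c ∈ sites ] (⟦ Q π ⟧ * ⟦ IsSite π c ⟧)       ≡⟨ ∑-*ˡ sites ⟦ Q π ⟧ _ ⟩
      ⟦ Q π ⟧ * ∑[ c ∈ sites ] ⟦ IsSite π c ⟧         ≡⟨ cong (⟦ Q π ⟧ *_) (sites-count (T-of π∈)) ⟩
      ⟦ Q π ⟧ * suc d                                  ≡⟨ *-comm ⟦ Q π ⟧ (suc d) ⟩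
      suc d * ⟦ Q π ⟧                                  ≡⟨ cong (suc d *_) (+-identityʳ _) ⟨
      suc d * (⟦ Q π ⟧ + 0)                            ∎

  prob-antitone : (qA : V → Bool) (qB : W → Bool) →
                  (∀ {σ} c → T (inA σ) → T (qB (insert σ c)) → T (qA σ)) →
                  prob qB (filterᵇ inB EB) ≤ℚ prob qA (filterᵇ inA EA)
  prob-antitone qA qB q-antitone = prob-≤ qA (filterᵇ inA EA) qB (filterᵇ inB EB) (length sites) d counts sizes
    where
    open ≤-Reasoning
    count-filter : ∀ {X : Set} (p q : X → Bool) xs → countᵇ q (filterᵇ p xs) ≡ ∑[ x ∈ xs ] (⟦ p x ⟧ * ⟦ q x ⟧)
    count-filter p q xs = trans (countᵇ≡∑ q (filterᵇ p xs)) (∑-filterᵇ p xs _)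
    length-filter : ∀ {X : Set} (p : X → Bool) xs → length (filterᵇ p xs) ≡ ∑[ x ∈ xs ] (⟦ p x ⟧ * 1)
    length-filter p xs = trans (length≡∑ (filterᵇ p xs)) (∑-filterᵇ p xs _)
    term-≤ : ∀ c σ → ⟦ inA σ ⟧ * ⟦ qB (insert σ c) ⟧ ≤ ⟦ inA σ ⟧ * ⟦ qA σ ⟧
    term-≤ c σ with inA σ in σ∈ | qB (insert σ c) in q-ins
    ... | false | _     = z≤n
    ... | true  | false = z≤n
    ... | true  | true  with qA σ | q-antitone c (T-of σ∈) (T-of q-ins)
    ...   | true | _ = ≤-refl
    counts : suc d * countᵇ qB (filterᵇ inB EB) ≤ length sites * countᵇ qA (filterᵇ inA EA)
    counts = begin
      suc d * countᵇ qB (filterᵇ inB EB)                      ≡⟨ cong (suc d *_) (count-filter inB qB EB) ⟩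
      suc d * ∑[ π ∈ EB ] (⟦ inB π ⟧ * ⟦ qB π ⟧)              ≡⟨ count-insertions qB ⟨
      ∑[ c ∈ sites ] ∑[ σ ∈ EA ] (⟦ inA σ ⟧ * ⟦ qB (insert σ c) ⟧)
                                                              ≤⟨ ∑-mono-≤ sites (λ c → ∑-mono-≤ EA (term-≤ c)) ⟩
      ∑[ c ∈ sites ] ∑[ σ ∈ EA ] (⟦ inA σ ⟧ * ⟦ qA σ ⟧)       ≡⟨ ∑-const sites _ ⟩
      length sites * ∑[ σ ∈ EA ] (⟦ inA σ ⟧ * ⟦ qA σ ⟧)       ≡⟨ cong (length sites *_) (count-filter inA qA EA) ⟨
      length sites * countᵇ qA (filterᵇ inA EA)               ∎
    sizes : suc d * length (filterᵇ inB EB) ≡ length sites * length (filterᵇ inA EA)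
    sizes = begin-equality
      suc d * length (filterᵇ inB EB)                         ≡⟨ cong (suc d *_) (length-filter inB EB) ⟩
      suc d * ∑[ π ∈ EB ] (⟦ inB π ⟧ * 1)                     ≡⟨ count-insertions (λ _ → true) ⟨
      ∑[ c ∈ sites ] ∑[ σ ∈ EA ] (⟦ inA σ ⟧ * 1)              ≡⟨ ∑-const sites _ ⟩
      length sites * ∑[ σ ∈ EA ] (⟦ inA σ ⟧ * 1)              ≡⟨ cong (length sites *_) (length-filter inA EA) ⟨
      length sites * length (filterᵇ inA EA)                  ∎

prob-cong : (p q : A → Bool) (xs : List A) → (∀ x → p x ≡ q x) → prob p xs ≡ prob q xs
prob-cong p q xs p≗q with length xs
... | zero  = refl
... | suc n = cong (λ c → ℤ.+ c / suc n) (begin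
  countᵇ p xs          ≡⟨ countᵇ≡∑ p xs ⟩
  ∑[ x ∈ xs ] ⟦ p x ⟧  ≡⟨ ∑-cong xs (cong ⟦_⟧ ∘ p≗q) ⟩
  ∑[ x ∈ xs ] ⟦ q x ⟧  ≡⟨ countᵇ≡∑ q xs ⟨
  countᵇ q xs          ∎)
  where open ≡-Reasoning

⊆⇒∈-subseqs : {s w : List A} → s ⊆ w → s ∈ subseqs w
⊆⇒∈-subseqs []                 = here refl
⊆⇒∈-subseqs (y ∷ʳ s⊆w)         = ∈-++⁺ˡ (⊆⇒∈-subseqs s⊆w)
⊆⇒∈-subseqs {w = x ∷ w} (refl ∷ s⊆w) = ∈-++⁺ʳ (subseqs w) (∈-map⁺ (x ∷_) (⊆⇒∈-subseqs s⊆w))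

∈-subseqs⇒⊆ : (w : List A) {s : List A} → s ∈ subseqs w → s ⊆ w
∈-subseqs⇒⊆ []      (here refl) = []
∈-subseqs⇒⊆ (x ∷ w) s∈ with ∈-++⁻ (subseqs w) s∈
... | inj₁ s∈w = x ∷ʳ ∈-subseqs⇒⊆ w s∈w
... | inj₂ s∈xw with ∈-map⁻ (x ∷_) s∈xw
...   | t , t∈ , refl = refl ∷ ∈-subseqs⇒⊆ w t∈

⊆-map⁻ : (F : B → A) (xs : List B) {s : List A} → s ⊆ map F xs → Σ (List B) (λ t → t ⊆ xs × s ≡ map F t)
⊆-map⁻ F []       []             = [] , [] , refl
⊆-map⁻ F (x ∷ xs) (_ ∷ʳ s⊆)      with ⊆-map⁻ F xs s⊆
... | t , t⊆ , refl = t , x ∷ʳ t⊆ , refl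
⊆-map⁻ F (x ∷ xs) (refl ∷ s⊆)    with ⊆-map⁻ F xs s⊆
... | t , t⊆ , refl = x ∷ t , refl ∷ t⊆ , refl

module _ (c : List A → Bool) where

  maxLength : List (List A) → ℕ
  maxLength ss = maxList (map length (filterᵇ c ss))

  maxLength-≥ : (ss : List (List A)) {s : List A} → s ∈ ss → c s ≡ true → length s ≤ maxLength ss
  maxLength-≥ (s ∷ ss) (here refl) cs with c s
  maxLength-≥ (s ∷ ss) (here refl) refl | true = m≤m⊔n _ _
  maxLength-≥ (t ∷ ss) (there s∈) cs with c t
  ... | true  = ≤-trans (maxLength-≥ ss s∈ cs) (m≤n⊔m _ _)
  ... | false = maxLength-≥ ss s∈ cs

  maxLength-≤ : (ss : List (List A)) {K : ℕ} → (∀ {s} → s ∈ ss → c s ≡ true → length s ≤ K) → maxLength ss ≤ K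
  maxLength-≤ []       bound = z≤n
  maxLength-≤ (s ∷ ss) bound with c s in cs
  ... | true  = ⊔-lub (bound (here refl) cs) (maxLength-≤ ss (λ s∈ → bound (there s∈)))
  ... | false = maxLength-≤ ss (λ s∈ → bound (there s∈))

longestChain : (ℤ → ℤ → Bool) → List ℤ → ℕ
longestChain r w = maxLength (chainᵇ r) (subseqs w)

module _ (r : ℤ → ℤ → Bool) where

  longestChain-≥ : {s w : List ℤ} → s ⊆ w → chainᵇ r s ≡ true → length s ≤ longestChain r w
  longestChain-≥ {w = w} s⊆w = maxLength-≥ (chainᵇ r) (subseqs w) (⊆⇒∈-subseqs s⊆w)

  longestChain-≤ : (w : List ℤ) {K : ℕ} → (∀ {s} → s ⊆ w → chainᵇ r s ≡ true → length s ≤ K) → longestChain r w ≤ K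
  longestChain-≤ w bound = maxLength-≤ (chainᵇ r) (subseqs w) (λ s∈ → bound (∈-subseqs⇒⊆ w s∈))

  longestChain-mono-⊆ : {w w′ : List ℤ} → w ⊆ w′ → longestChain r w ≤ longestChain r w′
  longestChain-mono-⊆ {w} w⊆w′ = longestChain-≤ w (λ s⊆w → longestChain-≥ (⊆-trans s⊆w w⊆w′))

  chainᵇ-relabel : (F G : B → ℤ) → (∀ x y → r (F x) (F y) ≡ r (G x) (G y)) →
                   ∀ s → chainᵇ r (map F s) ≡ chainᵇ r (map G s)
  chainᵇ-relabel F G same []          = refl
  chainᵇ-relabel F G same (x ∷ [])    = refl
  chainᵇ-relabel F G same (x ∷ y ∷ s) = cong₂ _∧_ (same x y) (chainᵇ-relabel F G same (y ∷ s))

  longestChain-relabel-≤ : (F G : B → ℤ) → (∀ x y → r (F x) (F y) ≡ r (G x) (G y)) →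
                           ∀ xs → longestChain r (map F xs) ≤ longestChain r (map G xs)
  longestChain-relabel-≤ F G same xs = longestChain-≤ (map F xs) bound
    where
    bound : ∀ {s} → s ⊆ map F xs → chainᵇ r s ≡ true → length s ≤ longestChain r (map G xs)
    bound s⊆ chain with ⊆-map⁻ F xs s⊆
    ... | t , t⊆xs , refl =
      subst (_≤ longestChain r (map G xs)) (trans (List.length-map G t) (sym (List.length-map F t)))
            (longestChain-≥ (map⁺ G t⊆xs) (trans (sym (chainᵇ-relabel F G same t)) chain))

lookup-extensionality : {u v : Vec A n} → (∀ i → lookup u i ≡ lookup v i) → u ≡ v
lookup-extensionality {u = u} {v} u≗v = begin
  u                        ≡⟨ tabulate∘lookup u ⟨
  Vec.tabulate (lookup u)  ≡⟨ Vec.tabulate-cong u≗v ⟩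
  Vec.tabulate (lookup v)  ≡⟨ tabulate∘lookup v ⟩
  v                        ∎
  where open ≡-Reasoning

data PunchInView (a : Fin (suc n)) : Fin (suc n) → Set where
  at-pivot : PunchInView a a
  punched  : (y : Fin n) → PunchInView a (punchIn a y)

punchInView : (a x : Fin (suc n)) → PunchInView a x
punchInView a x with a Fin.≟ x
... | yes refl = at-pivot
... | no a≢x   = subst (PunchInView a) (punchIn-punchOut a≢x) (punched (punchOut a≢x))

punchIn-preimage : (a x : Fin (suc n)) → x ≢ a → Σ (Fin n) (λ y → punchIn a y ≡ x)
punchIn-preimage a x x≢a = punchOut (x≢a ∘ sym) , punchIn-punchOut (x≢a ∘ sym)

-- A vector v : Vec (Point n) n stores the involution i ↦ v i.  A point is a position together
-- with a label: plain involutions use a single label, signed ones the sign of π (i).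
record PointLabelling : Set₁ where
  field
    Label                : Set
    _≟ᴸ_                 : DecidableEquality Label
    labels               : List Label
    labels-enumerate     : Enumerates _≟ᴸ_ labels
    Point                : ℕ → Set
    _≟ₚ_                 : DecidableEquality (Point n)
    points               : ∀ n → List (Point n)
    points-enumerate     : ∀ n → Enumerates _≟ₚ_ (points n)
    point                : Label → Fin n → Point n
    label                : Point n → Label
    position             : Point n → Fin n
    label-point          : ∀ t (i : Fin n) → label (point t i) ≡ t
    position-point       : ∀ t (i : Fin n) → position (point t i) ≡ i
    point-label-position : (p : Point n) → point (label p) (position p) ≡ p

module Involutions (Λ : PointLabelling) where

  open PointLabelling Λ

  point-injective : ∀ {s t} {i j : Fin n} → point s i ≡ point t j → s ≡ t × i ≡ j
  point-injective {s = s} {t} {i} {j} eq =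
    trans (sym (label-point s i)) (trans (cong label eq) (label-point t j)) ,
    trans (sym (position-point s i)) (trans (cong position eq) (position-point t j))

  shift : (Fin m → Fin n) → Point m → Point n
  shift f p = point (label p) (f (position p))

  label-shift : (f : Fin m → Fin n) (p : Point m) → label (shift f p) ≡ label p
  label-shift f p = label-point (label p) _

  position-shift : (f : Fin m → Fin n) (p : Point m) → position (shift f p) ≡ f (position p)
  position-shift f p = position-point (label p) _

  shift-point : (f : Fin m → Fin n) (t : Label) (i : Fin m) → shift f (point t i) ≡ point t (f i)
  shift-point f t i = cong₂ point (label-point t i) (cong f (position-point t i))

  shift-∘ : (f : Fin m → Fin n) (g : Fin k → Fin m) (p : Point k) → shift (f ∘ g) p ≡ shift f (shift g p)
  shift-∘ f g p = cong₂ point (sym (label-shift g p)) (cong f (sym (position-shift g p)))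

  shift-injective : {f : Fin m → Fin n} → (∀ {x y} → f x ≡ f y → x ≡ y) →
                    ∀ {p q} → shift f p ≡ shift f q → p ≡ q
  shift-injective {f = f} f-inj {p} {q} eq with point-injective eq
  ... | same-label , same-position = begin
    p                            ≡⟨ point-label-position p ⟨
    point (label p) (position p) ≡⟨ cong₂ point same-label (f-inj same-position) ⟩
    point (label q) (position q) ≡⟨ point-label-position q ⟩
    q                            ∎
    where open ≡-Reasoning

  𝟙-point : (z : Point n) (t : Label) (i : Fin n) → 𝟙 (z ≟ₚ point t i) ≡ 𝟙 (label z ≟ᴸ t) * 𝟙 (position z Fin.≟ i)
  𝟙-point z t i = 𝟙-× (label z ≟ᴸ t) (position z Fin.≟ i) (z ≟ₚ point t i)
    (λ { refl → label-point t i , position-point t i })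
    (λ { refl refl → sym (point-label-position z) })

  ∑-𝟙-point : (z : Point n) → ∑[ t ∈ labels ] ∑[ i ∈ allFin n ] 𝟙 (z ≟ₚ point t i) ≡ 1
  ∑-𝟙-point {n} z = begin
    ∑[ t ∈ labels ] ∑[ i ∈ allFin n ] 𝟙 (z ≟ₚ point t i)
      ≡⟨ ∑-cong labels (λ t → ∑-cong (allFin n) (𝟙-point z t)) ⟩
    ∑[ t ∈ labels ] ∑[ i ∈ allFin n ] (𝟙 (label z ≟ᴸ t) * 𝟙 (position z Fin.≟ i))
      ≡⟨ ∑-cong labels (λ t → ∑-*ˡ (allFin n) (𝟙 (label z ≟ᴸ t)) _) ⟩
    ∑[ t ∈ labels ] (𝟙 (label z ≟ᴸ t) * ∑[ i ∈ allFin n ] 𝟙 (position z Fin.≟ i))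
      ≡⟨ ∑-cong labels (λ t → cong (𝟙 (label z ≟ᴸ t) *_)
           (trans (∑-cong (allFin n) (λ i → 𝟙-cong (position z Fin.≟ i) (i Fin.≟ position z) sym sym))
                  (occurs-once (allFin-enumerates n) (position z)))) ⟩
    ∑[ t ∈ labels ] (𝟙 (label z ≟ᴸ t) * 1)
      ≡⟨ ∑-cong labels (λ t → trans (*-identityʳ _) (𝟙-cong (label z ≟ᴸ t) (t ≟ᴸ label z) sym sym)) ⟩
    ∑[ t ∈ labels ] 𝟙 (t ≟ᴸ label z)
      ≡⟨ occurs-once labels-enumerate (label z) ⟩
    1 ∎
    where open ≡-Reasoning

  InvolutiveAt : Vec (Point n) n → Fin n → Set
  InvolutiveAt v x = lookup v (position (lookup v x)) ≡ point (label (lookup v x)) x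

  IsInvolution : Vec (Point n) n → Set
  IsInvolution v = ∀ x → InvolutiveAt v x

  fixedCount : Vec (Point n) n → Label → ℕ
  fixedCount {n} v t = ∑[ i ∈ allFin n ] 𝟙 (lookup v i ≟ₚ point t i)

  partner-position : (v : Vec (Point n) n) → IsInvolution v → ∀ {x a} →
                     position (lookup v x) ≡ a → position (lookup v a) ≡ x
  partner-position v inv {x} refl = trans (cong position (inv x)) (position-point _ x)

  involutive-pair : (v : Vec (Point n) n) {a b : Fin n} (t : Label) →
                    lookup v a ≡ point t b → lookup v b ≡ point t a → InvolutiveAt v a
  involutive-pair v {a} {b} t va vb = begin
    lookup v (position (lookup v a))  ≡⟨ cong (lookup v ∘ position) va ⟩
    lookup v (position (point t b))   ≡⟨ cong (lookup v) (position-point t b) ⟩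
    lookup v b                        ≡⟨ vb ⟩
    point t a                         ≡⟨ cong (λ p → point p a) (trans (sym (label-point t b)) (cong label (sym va))) ⟩
    point (label (lookup v a)) a      ∎
    where open ≡-Reasoning

  record Extends (π : Vec (Point n) n) (τ : Fin m → Fin n) (σ : Vec (Point m) m) : Set where
    constructor extends
    field
      lookup-image : ∀ y → lookup π (τ y) ≡ shift τ (lookup σ y)

  open Extends public

  module _ {π : Vec (Point n) n} {τ : Fin m → Fin n} {σ : Vec (Point m) m} (π⊒σ : Extends π τ σ) where

    private
      π∘τ≡ = lookup-image π⊒σ

    involutive-on-image : IsInvolution σ → ∀ y → InvolutiveAt π (τ y)
    involutive-on-image inv y = begin
      lookup π (position (lookup π (τ y)))            ≡⟨ cong (lookup π ∘ position) (π∘τ≡ y) ⟩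
      lookup π (position (shift τ (lookup σ y)))      ≡⟨ cong (lookup π) (position-shift τ _) ⟩
      lookup π (τ (position (lookup σ y)))            ≡⟨ π∘τ≡ _ ⟩
      shift τ (lookup σ (position (lookup σ y)))      ≡⟨ cong (shift τ) (inv y) ⟩
      shift τ (point (label (lookup σ y)) y)          ≡⟨ shift-point τ _ y ⟩
      point (label (lookup σ y)) (τ y)
        ≡⟨ cong (λ t → point t (τ y)) (trans (sym (label-shift τ _)) (cong label (sym (π∘τ≡ y)))) ⟩
      point (label (lookup π (τ y))) (τ y)            ∎
      where open ≡-Reasoning

    module _ (τ-injective : ∀ {x y} → τ x ≡ τ y → x ≡ y) where

      involution-restricts : IsInvolution π → IsInvolution σ
      involution-restricts inv y = shift-injective τ-injective (begin
        shift τ (lookup σ (position (lookup σ y)))      ≡⟨ π∘τ≡ _ ⟨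
        lookup π (τ (position (lookup σ y)))            ≡⟨ cong (lookup π) (position-shift τ _) ⟨
        lookup π (position (shift τ (lookup σ y)))      ≡⟨ cong (lookup π ∘ position) (π∘τ≡ y) ⟨
        lookup π (position (lookup π (τ y)))            ≡⟨ inv (τ y) ⟩
        point (label (lookup π (τ y))) (τ y)
          ≡⟨ cong (λ t → point t (τ y)) (trans (cong label (π∘τ≡ y)) (label-shift τ _)) ⟩
        point (label (lookup σ y)) (τ y)                ≡⟨ shift-point τ _ y ⟨
        shift τ (point (label (lookup σ y)) y)          ∎)
        where open ≡-Reasoning

      fixed-on-image : ∀ t y → 𝟙 (lookup π (τ y) ≟ₚ point t (τ y)) ≡ 𝟙 (lookup σ y ≟ₚ point t y)
      fixed-on-image t y = 𝟙-cong (lookup π (τ y) ≟ₚ point t (τ y)) (lookup σ y ≟ₚ point t y)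
        (λ eq → shift-injective τ-injective (trans (sym (π∘τ≡ y)) (trans eq (sym (shift-point τ t y)))))
        (λ eq → trans (π∘τ≡ y) (trans (cong (shift τ) eq) (shift-point τ t y)))

      extends-injective : {σ′ : Vec (Point m) m} → Extends π τ σ′ → σ ≡ σ′
      extends-injective π⊒σ′ =
        lookup-extensionality (λ y → shift-injective τ-injective (trans (sym (π∘τ≡ y)) (lookup-image π⊒σ′ y)))

  restrict : (π : Vec (Point n) n) (τ : Fin m → Fin n) →
             (∀ y → Σ (Fin m) (λ z → τ z ≡ position (lookup π (τ y)))) → Vec (Point m) m
  restrict π τ preimage = Vec.tabulate (λ y → point (label (lookup π (τ y))) (proj₁ (preimage y)))

  restrict-extends : (π : Vec (Point n) n) (τ : Fin m → Fin n)
                     (preimage : ∀ y → Σ (Fin m) (λ z → τ z ≡ position (lookup π (τ y)))) →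
                     Extends π τ (restrict π τ preimage)
  restrict-extends π τ preimage = extends image
    where
    image : ∀ y → lookup π (τ y) ≡ shift τ (lookup (restrict π τ preimage) y)
    image y = sym (begin
      shift τ (lookup (restrict π τ preimage) y)  ≡⟨ cong (shift τ) (lookup∘tabulate _ y) ⟩
      shift τ (point l z)                          ≡⟨ shift-point τ l z ⟩
      point l (τ z)                                ≡⟨ cong (point l) (proj₂ (preimage y)) ⟩
      point l (position (lookup π (τ y)))          ≡⟨ point-label-position _ ⟩
      lookup π (τ y)                               ∎)
      where
      open ≡-Reasoning
      l = label (lookup π (τ y))
      z = proj₁ (preimage y)

  insertFixed : Label → Fin (suc n) → Vec (Point n) n → Vec (Point (suc n)) (suc n)
  insertFixed t a σ = insertAt (Vec.map (shift (punchIn a)) σ) a (point t a)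

  module _ (t : Label) (a : Fin (suc n)) (σ : Vec (Point n) n) where

    insertFixed-pivot : lookup (insertFixed t a σ) a ≡ point t a
    insertFixed-pivot = insertAt-lookup _ a _

    insertFixed-extends : Extends (insertFixed t a σ) (punchIn a) σ
    insertFixed-extends = extends (λ y → trans (insertAt-punchIn _ a _ y) (lookup-map y _ σ))

    insertFixed-involution : IsInvolution σ → IsInvolution (insertFixed t a σ)
    insertFixed-involution inv x with punchInView a x
    ... | at-pivot  = involutive-pair (insertFixed t a σ) t insertFixed-pivot insertFixed-pivot
    ... | punched y = involutive-on-image insertFixed-extends inv y

    fixedCount-insertFixed : ∀ s → fixedCount (insertFixed t a σ) s ≡ 𝟙 (t ≟ᴸ s) + fixedCount σ s
    fixedCount-insertFixed s = trans (∑-allFin-punchIn a _) (cong₂ _+_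
      (𝟙-cong (lookup (insertFixed t a σ) a ≟ₚ point s a) (t ≟ᴸ s)
        (λ eq → proj₁ (point-injective (trans (sym insertFixed-pivot) eq)))
        (λ { refl → insertFixed-pivot }))
      (∑-cong (allFin _) (fixed-on-image insertFixed-extends (punchIn-injective a _ _) s)))

  module FixedPointRemoval {π : Vec (Point (suc n)) (suc n)} (inv : IsInvolution π) {t : Label} {a : Fin (suc n)}
                           (π-pivot : lookup π a ≡ point t a) where

    private
      preimage : ∀ y → Σ (Fin n) (λ z → punchIn a z ≡ position (lookup π (punchIn a y)))
      preimage y = punchIn-preimage a _ (λ eq → punchInᵢ≢i a y
        (trans (sym (partner-position π inv eq)) (trans (cong position π-pivot) (position-point t a))))

    removeFixed : Vec (Point n) n
    removeFixed = restrict π (punchIn a) preimage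

    removeFixed-extends : Extends π (punchIn a) removeFixed
    removeFixed-extends = restrict-extends π (punchIn a) preimage

    insertFixed-removeFixed : insertFixed t a removeFixed ≡ π
    insertFixed-removeFixed = lookup-extensionality agree
      where
      agree : ∀ x → lookup (insertFixed t a removeFixed) x ≡ lookup π x
      agree x with punchInView a x
      ... | at-pivot  = trans (insertFixed-pivot t a removeFixed) (sym π-pivot)
      ... | punched y = trans (lookup-image (insertFixed-extends t a removeFixed) y) (sym (lookup-image removeFixed-extends y))

  insertCycle : Label → Fin (suc (suc n)) → Fin (suc n) → Vec (Point n) n → Vec (Point (suc (suc n))) (suc (suc n))
  insertCycle t a b σ =
    insertAt (insertAt (Vec.map (shift (punchIn a ∘ punchIn b)) σ) b (point t a)) a (point t (punchIn a b))

  punchIn²-injective : (a : Fin (suc (suc n))) (b : Fin (suc n)) → ∀ {x y} →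
                       punchIn a (punchIn b x) ≡ punchIn a (punchIn b y) → x ≡ y
  punchIn²-injective a b eq = punchIn-injective b _ _ (punchIn-injective a _ _ eq)

  module _ (t : Label) (a : Fin (suc (suc n))) (b : Fin (suc n)) (σ : Vec (Point n) n) where

    insertCycle-pivot : lookup (insertCycle t a b σ) a ≡ point t (punchIn a b)
    insertCycle-pivot = insertAt-lookup _ a _

    insertCycle-partner : lookup (insertCycle t a b σ) (punchIn a b) ≡ point t a
    insertCycle-partner = trans (insertAt-punchIn _ a _ b) (insertAt-lookup _ b _)

    insertCycle-extends : Extends (insertCycle t a b σ) (punchIn a ∘ punchIn b) σ
    insertCycle-extends = extends (λ y →
      trans (insertAt-punchIn _ a _ (punchIn b y)) (trans (insertAt-punchIn _ b _ y) (lookup-map y _ σ)))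

    insertCycle-involution : IsInvolution σ → IsInvolution (insertCycle t a b σ)
    insertCycle-involution inv x with punchInView a x
    ... | at-pivot   = involutive-pair (insertCycle t a b σ) t insertCycle-pivot insertCycle-partner
    ... | punched x′ with punchInView b x′
    ...   | at-pivot  = involutive-pair (insertCycle t a b σ) t insertCycle-partner insertCycle-pivot
    ...   | punched y = involutive-on-image insertCycle-extends inv y

    fixedCount-insertCycle : ∀ s → fixedCount (insertCycle t a b σ) s ≡ fixedCount σ s
    fixedCount-insertCycle s = begin
      fixedCount π s
        ≡⟨ ∑-allFin-punchIn a fixedAt ⟩
      fixedAt a + ∑ (allFin _) (fixedAt ∘ punchIn a)
        ≡⟨ cong (fixedAt a +_) (∑-allFin-punchIn b (fixedAt ∘ punchIn a)) ⟩
      fixedAt a + (fixedAt (punchIn a b) + ∑ (allFin _) (fixedAt ∘ punchIn a ∘ punchIn b))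
        ≡⟨ cong₂ _+_ pivot-not-fixed (cong₂ _+_ partner-not-fixed
             (∑-cong (allFin _) (fixed-on-image insertCycle-extends (punchIn²-injective a b) s))) ⟩
      fixedCount σ s
        ∎
      where
      open ≡-Reasoning
      π = insertCycle t a b σ
      fixedAt : Fin (suc (suc _)) → ℕ
      fixedAt i = 𝟙 (lookup π i ≟ₚ point s i)
      pivot-not-fixed : fixedAt a ≡ 0
      pivot-not-fixed = 𝟙-no (lookup π a ≟ₚ point s a)
        (λ eq → punchInᵢ≢i a b (proj₂ (point-injective (trans (sym insertCycle-pivot) eq))))
      partner-not-fixed : fixedAt (punchIn a b) ≡ 0
      partner-not-fixed = 𝟙-no (lookup π (punchIn a b) ≟ₚ point s (punchIn a b))
        (λ eq → punchInᵢ≢i a b (sym (proj₂ (point-injective (trans (sym insertCycle-partner) eq)))))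

  module CycleRemoval {π : Vec (Point (suc (suc n))) (suc (suc n))} (inv : IsInvolution π)
                      {t : Label} {a : Fin (suc (suc n))} {b : Fin (suc n)}
                      (π-pivot : lookup π a ≡ point t (punchIn a b)) where

    private
      τ : Fin n → Fin (suc (suc n))
      τ = punchIn a ∘ punchIn b

      position-pivot : position (lookup π a) ≡ punchIn a b
      position-pivot = trans (cong position π-pivot) (position-point t _)

      π-partner : lookup π (punchIn a b) ≡ point t a
      π-partner = trans (cong (lookup π) (sym position-pivot))
                        (trans (inv a) (cong (λ l → point l a) (trans (cong label π-pivot) (label-point t _))))

      not-pivot : ∀ y → position (lookup π (τ y)) ≢ a
      not-pivot y eq = punchInᵢ≢i b y (punchIn-injective a _ _ (trans (sym (partner-position π inv eq)) position-pivot))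

      not-partner : ∀ y → position (lookup π (τ y)) ≢ punchIn a b
      not-partner y eq = punchInᵢ≢i a (punchIn b y)
        (trans (sym (partner-position π inv eq)) (trans (cong position π-partner) (position-point t a)))

      preimage : ∀ y → Σ (Fin n) (λ z → τ z ≡ position (lookup π (τ y)))
      preimage y with punchIn-preimage a _ (not-pivot y)
      ... | x′ , pa-x′ with punchIn-preimage b x′ (λ { refl → not-partner y (sym pa-x′) })
      ...   | z , pb-z = z , trans (cong (punchIn a) pb-z) pa-x′

    removeCycle : Vec (Point n) n
    removeCycle = restrict π τ preimage

    removeCycle-extends : Extends π τ removeCycle
    removeCycle-extends = restrict-extends π τ preimage

    insertCycle-removeCycle : insertCycle t a b removeCycle ≡ π
    insertCycle-removeCycle = lookup-extensionality agree
      where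
      agree : ∀ x → lookup (insertCycle t a b removeCycle) x ≡ lookup π x
      agree x with punchInView a x
      ... | at-pivot   = trans (insertCycle-pivot t a b removeCycle) (sym π-pivot)
      ... | punched x′ with punchInView b x′
      ...   | at-pivot  = trans (insertCycle-partner t a b removeCycle) (sym π-partner)
      ...   | punched y = trans (lookup-image (insertCycle-extends t a b removeCycle) y)
                                (sym (lookup-image removeCycle-extends y))

  -- Statistics are defined on all vectors of points, not only on square ones, so that their
  -- monotonicity can be stated for one insertAt or one relabelling at a time.
  record Statistic : Set where
    field
      measure          : ∀ {m n} → Vec (Point m) n → ℕ
      measure-insertAt : ∀ {m n} (xs : Vec (Point m) n) i p → measure xs ≤ measure (insertAt xs i p)
      measure-shift    : ∀ {m n} (a : Fin (suc m)) (xs : Vec (Point m) n) → measure xs ≤ measure (Vec.map (shift (punchIn a)) xs)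

    measure-insertFixed : ∀ t (a : Fin (suc n)) σ → measure σ ≤ measure (insertFixed t a σ)
    measure-insertFixed t a σ = ≤-trans (measure-shift a σ) (measure-insertAt _ a _)

    measure-insertCycle : ∀ t (a : Fin (suc (suc n))) b σ → measure σ ≤ measure (insertCycle t a b σ)
    measure-insertCycle t a b σ = begin
      measure σ                                               ≤⟨ measure-shift b σ ⟩
      measure (Vec.map (shift (punchIn b)) σ)                     ≤⟨ measure-shift a _ ⟩
      measure (Vec.map (shift (punchIn a)) (Vec.map (shift (punchIn b)) σ))
        ≡⟨ cong measure (trans (Vec.map-cong (shift-∘ (punchIn a) (punchIn b)) σ)
                               (Vec.map-∘ (shift (punchIn a)) (shift (punchIn b)) σ)) ⟨
      measure (Vec.map (shift (punchIn a ∘ punchIn b)) σ)         ≤⟨ measure-insertAt _ b _ ⟩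
      measure (insertAt (Vec.map (shift (punchIn a ∘ punchIn b)) σ) b (point t a))
                                                              ≤⟨ measure-insertAt _ a _ ⟩
      measure (insertCycle t a b σ)                           ∎
      where open ≤-Reasoning

  record ClassTest : Set where
    field
      inClass          : (Label → ℕ) → Vec (Point n) n → Bool
      inClass-sound    : ∀ {m} {v : Vec (Point n) n} → T (inClass m v) → IsInvolution v × (∀ t → fixedCount v t ≡ m t)
      inClass-complete : ∀ {m} {v : Vec (Point n) n} → IsInvolution v → (∀ t → fixedCount v t ≡ m t) → T (inClass m v)

  CycleSite : ℕ → Set
  CycleSite n = Label × Fin (suc (suc n)) × Fin (suc n)

  cycleSites : ∀ n → List (CycleSite n)
  cycleSites n = cartesianProduct labels (cartesianProduct (allFin (suc (suc n))) (allFin (suc n)))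

  IsCycleSite : Vec (Point (suc (suc n))) (suc (suc n)) → CycleSite n → Bool
  IsCycleSite π (t , a , b) = ⌊ lookup π a ≟ₚ point t (punchIn a b) ⌋

  -- Every position a of π is either fixed, or π a = point t (punchIn a b) for exactly one (t , b).
  cycleSites-count : (π : Vec (Point (suc (suc n))) (suc (suc n))) →
                     ∑[ t ∈ labels ] fixedCount π t + ∑[ c ∈ cycleSites n ] ⟦ IsCycleSite π c ⟧ ≡ suc (suc n)
  cycleSites-count {n} π = begin
    ∑[ t ∈ labels ] fixedCount π t + ∑[ c ∈ cycleSites n ] ⟦ IsCycleSite π c ⟧
      ≡⟨ cong (∑[ t ∈ labels ] fixedCount π t +_) sites-as-sums ⟩
    ∑[ t ∈ labels ] ∑[ a ∈ positions ] fixedAt t a + ∑[ t ∈ labels ] ∑[ a ∈ positions ] sitesAt t a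
      ≡⟨ ∑-+ labels ⟨
    ∑[ t ∈ labels ] (∑[ a ∈ positions ] fixedAt t a + ∑[ a ∈ positions ] sitesAt t a)
      ≡⟨ ∑-cong labels (λ t → ∑-+ {f = fixedAt t} {g = sitesAt t} positions) ⟨
    ∑[ t ∈ labels ] ∑[ a ∈ positions ] (fixedAt t a + sitesAt t a)
      ≡⟨ ∑-cong labels (λ t → ∑-cong positions (λ a → ∑-allFin-punchIn a (λ x → 𝟙 (lookup π a ≟ₚ point t x)))) ⟨
    ∑[ t ∈ labels ] ∑[ a ∈ positions ] ∑[ x ∈ positions ] 𝟙 (lookup π a ≟ₚ point t x)
      ≡⟨ ∑-comm labels positions _ ⟩
    ∑[ a ∈ positions ] ∑[ t ∈ labels ] ∑[ x ∈ positions ] 𝟙 (lookup π a ≟ₚ point t x)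
      ≡⟨ ∑-cong positions (λ a → ∑-𝟙-point (lookup π a)) ⟩
    ∑[ a ∈ positions ] 1
      ≡⟨ length≡∑ positions ⟨
    length positions
      ≡⟨ List.length-tabulate (λ i → i) ⟩
    suc (suc n)
      ∎
    where
    open ≡-Reasoning
    positions : List (Fin (suc (suc n)))
    positions = allFin (suc (suc n))
    fixedAt : Label → Fin (suc (suc n)) → ℕ
    fixedAt t a = 𝟙 (lookup π a ≟ₚ point t a)
    sitesAt : Label → Fin (suc (suc n)) → ℕ
    sitesAt t a = ∑[ b ∈ allFin (suc n) ] 𝟙 (lookup π a ≟ₚ point t (punchIn a b))
    sites-as-sums : ∑[ c ∈ cycleSites n ] ⟦ IsCycleSite π c ⟧ ≡ ∑[ t ∈ labels ] ∑[ a ∈ positions ] sitesAt t a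
    sites-as-sums = trans (∑-cartesianProduct labels _ _)
      (∑-cong labels (λ t → ∑-cartesianProduct positions (allFin (suc n)) (λ ab → ⟦ IsCycleSite π (t , ab) ⟧)))

  module _ (C : ClassTest) where

    open ClassTest C

    fixedPointInsertion : (m m′ : Label → ℕ) (t : Label) → (∀ s → m′ s ≡ 𝟙 (t ≟ᴸ s) + m s) →
                          RegularInsertion (inClass {n} m) (inClass {suc n} m′) (allFin (suc n)) (m t)
    fixedPointInsertion {n} m m′ t m′≡ = record
      { insert            = λ σ a → insertFixed t a σ
      ; IsSite            = λ π a → ⌊ lookup π a ≟ₚ point t a ⌋
      ; insert-∈          = insert-∈
      ; insert-isSite     = λ {σ} a _ → fromWitness (insertFixed-pivot t a σ)
      ; insert-injective  = insert-injective
      ; insert-surjective = insert-surjective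
      ; sites-count       = sites-count
      }
      where
      insert-∈ : ∀ {σ} a → T (inClass m σ) → T (inClass m′ (insertFixed t a σ))
      insert-∈ {σ} a σ∈ = inClass-complete (insertFixed-involution t a σ inv) (λ s → begin
        fixedCount (insertFixed t a σ) s  ≡⟨ fixedCount-insertFixed t a σ s ⟩
        𝟙 (t ≟ᴸ s) + fixedCount σ s       ≡⟨ cong (𝟙 (t ≟ᴸ s) +_) (fix s) ⟩
        𝟙 (t ≟ᴸ s) + m s                  ≡⟨ m′≡ s ⟨
        m′ s                              ∎)
        where
        open ≡-Reasoning
        inv = proj₁ (inClass-sound σ∈)
        fix = proj₂ (inClass-sound σ∈)

      insert-injective : ∀ {σ σ′} a → T (inClass m σ) → T (inClass m σ′) →
                         insertFixed t a σ ≡ insertFixed t a σ′ → σ ≡ σ′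
      insert-injective {σ} {σ′} a _ _ eq = extends-injective (insertFixed-extends t a σ) (punchIn-injective a _ _)
        (subst (λ π → Extends π (punchIn a) σ′) (sym eq) (insertFixed-extends t a σ′))

      insert-surjective : ∀ {π} a → T (inClass m′ π) → T (⌊ lookup π a ≟ₚ point t a ⌋) →
                          Σ (Vec (Point n) n) (λ σ → T (inClass m σ) × insertFixed t a σ ≡ π)
      insert-surjective {π} a π∈ site = σ , inClass-complete σ-inv σ-fix , insertFixed-removeFixed
        where
        inv = proj₁ (inClass-sound π∈)
        open FixedPointRemoval {π = π} inv {t} {a} (toWitness site)
        σ     = removeFixed
        σ-inv = involution-restricts removeFixed-extends (punchIn-injective a _ _) inv
        σ-fix : ∀ s → fixedCount σ s ≡ m s
        σ-fix s = +-cancelˡ-≡ (𝟙 (t ≟ᴸ s)) _ _ (begin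
          𝟙 (t ≟ᴸ s) + fixedCount σ s        ≡⟨ fixedCount-insertFixed t a σ s ⟨
          fixedCount (insertFixed t a σ) s   ≡⟨ cong (λ v → fixedCount v s) insertFixed-removeFixed ⟩
          fixedCount π s                     ≡⟨ proj₂ (inClass-sound π∈) s ⟩
          m′ s                               ≡⟨ m′≡ s ⟩
          𝟙 (t ≟ᴸ s) + m s                   ∎)
          where open ≡-Reasoning

      sites-count : ∀ {π} → T (inClass m′ π) → fixedCount π t ≡ suc (m t)
      sites-count π∈ = trans (proj₂ (inClass-sound π∈) t) (trans (m′≡ t) (cong (_+ m t) (𝟙-yes (t ≟ᴸ t) refl)))

    cycleInsertion : (m : Label → ℕ) (d : ℕ) → ∑[ t ∈ labels ] m t + suc d ≡ suc (suc n) →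
                     RegularInsertion (inClass {n} m) (inClass {suc (suc n)} m) (cycleSites n) d
    cycleInsertion {n} m d size = record
      { insert            = λ σ (t , a , b) → insertCycle t a b σ
      ; IsSite            = IsCycleSite
      ; insert-∈          = insert-∈
      ; insert-isSite     = λ {σ} (t , a , b) _ → fromWitness (insertCycle-pivot t a b σ)
      ; insert-injective  = insert-injective
      ; insert-surjective = insert-surjective
      ; sites-count       = sites-count
      }
      where
      insert-∈ : ∀ {σ} ((t , a , b) : CycleSite n) → T (inClass m σ) → T (inClass m (insertCycle t a b σ))
      insert-∈ {σ} (t , a , b) σ∈ = inClass-complete (insertCycle-involution t a b σ (proj₁ (inClass-sound σ∈)))
        (λ s → trans (fixedCount-insertCycle t a b σ s) (proj₂ (inClass-sound σ∈) s))

      insert-injective : ∀ {σ σ′} ((t , a , b) : CycleSite n) → T (inClass m σ) → T (inClass m σ′) →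
                         insertCycle t a b σ ≡ insertCycle t a b σ′ → σ ≡ σ′
      insert-injective {σ} {σ′} (t , a , b) _ _ eq = extends-injective (insertCycle-extends t a b σ) (punchIn²-injective a b)
        (subst (λ π → Extends π (punchIn a ∘ punchIn b) σ′) (sym eq) (insertCycle-extends t a b σ′))

      insert-surjective : ∀ {π} ((t , a , b) : CycleSite n) → T (inClass m π) → T (IsCycleSite π (t , a , b)) →
                          Σ (Vec (Point n) n) (λ σ → T (inClass m σ) × insertCycle t a b σ ≡ π)
      insert-surjective {π} (t , a , b) π∈ site = σ , inClass-complete σ-inv σ-fix , insertCycle-removeCycle
        where
        inv = proj₁ (inClass-sound π∈)
        open CycleRemoval {π = π} inv {t} {a} {b} (toWitness site)
        σ     = removeCycle
        σ-inv = involution-restricts removeCycle-extends (punchIn²-injective a b) inv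
        σ-fix : ∀ s → fixedCount σ s ≡ m s
        σ-fix s = begin
          fixedCount σ s                     ≡⟨ fixedCount-insertCycle t a b σ s ⟨
          fixedCount (insertCycle t a b σ) s ≡⟨ cong (λ v → fixedCount v s) insertCycle-removeCycle ⟩
          fixedCount π s                     ≡⟨ proj₂ (inClass-sound π∈) s ⟩
          m s                                ∎
          where open ≡-Reasoning

      sites-count : ∀ {π} → T (inClass m π) → ∑[ c ∈ cycleSites n ] ⟦ IsCycleSite π c ⟧ ≡ suc d
      sites-count {π} π∈ = +-cancelˡ-≡ (∑[ t ∈ labels ] m t) _ _ (begin
        ∑[ t ∈ labels ] m t + ∑[ c ∈ cycleSites n ] ⟦ IsCycleSite π c ⟧
          ≡⟨ cong (_+ _) (∑-cong labels (proj₂ (inClass-sound π∈))) ⟨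
        ∑[ t ∈ labels ] fixedCount π t + ∑[ c ∈ cycleSites n ] ⟦ IsCycleSite π c ⟧
          ≡⟨ cycleSites-count π ⟩
        suc (suc n)
          ≡⟨ size ⟨
        ∑[ t ∈ labels ] m t + suc d ∎)
        where open ≡-Reasoning

  module Steps (C : ClassTest) (L : Statistic) (l : ℤ) where

    open ClassTest C
    open Statistic L

    AtMost : Vec (Point n) n → Bool
    AtMost v = ⌊ ℤ.+ measure v ℤ.≤? l ⌋

    Pr : (n : ℕ) → (Label → ℕ) → ℚ
    Pr n m = prob AtMost (filterᵇ (inClass m) (allVecs (points n) n))

    AtMost-antitone : {u : Vec (Point m) m} {v : Vec (Point n) n} → measure u ≤ measure v → T (AtMost v) → T (AtMost u)
    AtMost-antitone u≤v v≤l = fromWitness (ℤ.≤-trans (ℤ.+≤+ u≤v) (toWitness v≤l))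

    allVecs-points-enumerate : ∀ n → Enumerates (Vec.≡-dec _≟ₚ_) (allVecs (points n) n)
    allVecs-points-enumerate n = allVecs-enumerates (points-enumerate n) n

    fixedPoint-step : ∀ n (m m′ : Label → ℕ) t → (∀ s → m′ s ≡ 𝟙 (t ≟ᴸ s) + m s) → Pr (suc n) m′ ≤ℚ Pr n m
    fixedPoint-step n m m′ t m′≡ =
      prob-antitone (allVecs-points-enumerate n) (allVecs-points-enumerate (suc n)) (fixedPointInsertion C m m′ t m′≡)
        AtMost AtMost (λ {σ} a _ → AtMost-antitone (measure-insertFixed t a σ))

    cycle-step : ∀ n (m : Label → ℕ) d → ∑[ t ∈ labels ] m t + suc d ≡ suc (suc n) → Pr (suc (suc n)) m ≤ℚ Pr n m
    cycle-step n m d size =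
      prob-antitone (allVecs-points-enumerate n) (allVecs-points-enumerate (suc (suc n))) (cycleInsertion C m d size)
        AtMost AtMost (λ {σ} (t , a , b) _ → AtMost-antitone (measure-insertCycle t a b σ))

T-allᵇ⁻ : (p : A → Bool) (xs : List A) → T (allᵇ p xs) → ∀ {x} → x ∈ xs → T (p x)
T-allᵇ⁻ p (y ∷ xs) all (here refl) = proj₁ (Equivalence.to T-∧ all)
T-allᵇ⁻ p (y ∷ xs) all (there x∈)  = T-allᵇ⁻ p xs (proj₂ (Equivalence.to T-∧ all)) x∈

T-allᵇ⁺ : (p : A → Bool) (xs : List A) → (∀ {x} → x ∈ xs → T (p x)) → T (allᵇ p xs)
T-allᵇ⁺ p []       all = _
T-allᵇ⁺ p (y ∷ xs) all = Equivalence.from T-∧ (all (here refl) , T-allᵇ⁺ p xs (all ∘ there))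

toList-⊆-insertAt : (xs : Vec A n) (i : Fin (suc n)) (x : A) → toList xs ⊆ toList (insertAt xs i x)
toList-⊆-insertAt xs            zero    x = x ∷ʳ ⊆-refl
toList-⊆-insertAt (y Vec.∷ xs)  (suc i) x = refl ∷ toList-⊆-insertAt xs i x

toList≡map-lookup : (v : Vec A n) → toList v ≡ map (lookup v) (allFin n)
toList≡map-lookup Vec.[] = refl
toList≡map-lookup {n = suc n} (x Vec.∷ v) = cong (x ∷_) (begin
  toList v                                ≡⟨ toList≡map-lookup v ⟩
  map (lookup v) (allFin n)               ≡⟨ List.map-tabulate (λ i → i) (lookup v) ⟩
  tabulate (lookup v)                     ≡⟨ List.map-tabulate suc (lookup (x Vec.∷ v)) ⟨
  map (lookup (x Vec.∷ v)) (tabulate suc) ∎)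
  where open ≡-Reasoning

RespectsOrder : (ℤ → ℤ → Bool) → Set₁
RespectsOrder r = ∀ {X : Set} (F G : X → ℤ) → (∀ x y → F x ℤ.< F y ⇔ G x ℤ.< G y) →
                  ∀ x y → r (F x) (F y) ≡ r (G x) (G y)

<ᵇ-respectsOrder : RespectsOrder _<ᵇ_
<ᵇ-respectsOrder F G same x y =
  ⌊⌋-cong (F x ℤ.<? F y) (G x ℤ.<? G y) (Equivalence.to (same x y)) (Equivalence.from (same x y))

>ᵇ-respectsOrder : RespectsOrder _>ᵇ_
>ᵇ-respectsOrder F G same x y = <ᵇ-respectsOrder F G same y x

punchIn-<⇔ : (a : Fin (suc n)) {x y : Fin n} → x Fin.< y ⇔ punchIn a x Fin.< punchIn a y
punchIn-<⇔ a {x} {y} = mk⇔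
  (λ x<y → ℕ.≰⇒> (λ ax≥ay → ℕ.<⇒≱ x<y (punchIn-cancel-≤ a y x ax≥ay)))
  (λ ax<ay → ℕ.≰⇒> (λ x≥y → ℕ.<⇒≱ ax<ay (punchIn-mono-≤ a y x x≥y)))

allᵇ-map : (p : A → Bool) (f : B → A) (xs : List B) → allᵇ p (map f xs) ≡ allᵇ (p ∘ f) xs
allᵇ-map p f []       = refl
allᵇ-map p f (x ∷ xs) = cong (p (f x) ∧_) (allᵇ-map p f xs)

value : Fin m → ℤ
value i = ℤ.+ suc (toℕ i)

value-<⁺ : {x y : Fin m} → x Fin.< y → value x ℤ.< value y
value-<⁺ x<y = ℤ.+<+ (ℕ.s<s x<y)

value-<⁻ : {x y : Fin m} → value x ℤ.< value y → x Fin.< y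
value-<⁻ lt = ℕ.s<s⁻¹ (ℤ.drop‿+<+ lt)

value-punchIn-<⇔ : (a : Fin (suc m)) (x y : Fin m) →
                   value x ℤ.< value y ⇔ value (punchIn a x) ℤ.< value (punchIn a y)
value-punchIn-<⇔ a x y = mk⇔
  (value-<⁺ ∘ Equivalence.to (punchIn-<⇔ a) ∘ value-<⁻)
  (value-<⁺ ∘ Equivalence.from (punchIn-<⇔ a) ∘ value-<⁻)

module Unsigned where

  unsignedPoints : PointLabelling
  unsignedPoints = record
    { Label                = ⊤
    ; _≟ᴸ_                 = Unit._≟_
    ; labels               = tt ∷ []
    ; labels-enumerate     = record { occurs-once = λ _ → refl }
    ; Point                = Fin
    ; _≟ₚ_                 = Fin._≟_
    ; points               = allFin
    ; points-enumerate     = allFin-enumerates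
    ; point                = λ _ i → i
    ; label                = λ _ → tt
    ; position             = λ i → i
    ; label-point          = λ _ _ → refl
    ; position-point       = λ _ _ → refl
    ; point-label-position = λ _ → refl
    }

  open Involutions unsignedPoints using (IsInvolution; fixedCount; ClassTest; Statistic; module Steps)

  involutionClasses : ClassTest
  involutionClasses = record
    { inClass          = λ m v → isInvolution v ∧ (numFixed v ℕ.≡ᵇ m tt)
    ; inClass-sound    = λ {_} {m} {v} → sound m v
    ; inClass-complete = λ {_} {m} {v} → complete m v
    }
    where
    isInvolution⇔ : (v : Vec (Fin n) n) → T (isInvolution v) ⇔ IsInvolution v
    isInvolution⇔ {n} v = mk⇔
      (λ inv i → toWitness (T-allᵇ⁻ involutiveAt (allFin n) inv (∈-allFin i)))
      (λ inv → T-allᵇ⁺ involutiveAt (allFin n) (λ {i} _ → fromWitness (inv i)))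
      where
      involutiveAt : Fin n → Bool
      involutiveAt i = ⌊ lookup v (lookup v i) Fin.≟ i ⌋

    numFixed≡fixedCount : (v : Vec (Fin n) n) → numFixed v ≡ fixedCount v tt
    numFixed≡fixedCount {n} v = countᵇ≡∑ (λ i → ⌊ lookup v i Fin.≟ i ⌋) (allFin n)

    sound : ∀ m (v : Vec (Fin n) n) → T (isInvolution v ∧ (numFixed v ℕ.≡ᵇ m tt)) →
            IsInvolution v × (∀ t → fixedCount v t ≡ m t)
    sound m v h with Equivalence.to T-∧ h
    ... | inv , fix = Equivalence.to (isInvolution⇔ v) inv ,
                      λ _ → trans (sym (numFixed≡fixedCount v)) (ℕ.≡ᵇ⇒≡ (numFixed v) (m tt) fix)

    complete : ∀ m (v : Vec (Fin n) n) → IsInvolution v → (∀ t → fixedCount v t ≡ m t) →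
               T (isInvolution v ∧ (numFixed v ℕ.≡ᵇ m tt))
    complete m v inv fix = Equivalence.from T-∧
      (Equivalence.from (isInvolution⇔ v) inv , ℕ.≡⇒≡ᵇ (numFixed v) (m tt) (trans (numFixed≡fixedCount v) (fix tt)))

  valueWord : Vec (Fin m) n → List ℤ
  valueWord xs = map value (toList xs)

  chainStatistic : (r : ℤ → ℤ → Bool) → RespectsOrder r → Statistic
  chainStatistic r r-respects = record
    { measure          = λ xs → longestChain r (valueWord xs)
    ; measure-insertAt = λ xs i x → longestChain-mono-⊆ r (map⁺ value (toList-⊆-insertAt xs i x))
    ; measure-shift    = measure-shift
    }
    where
    measure-shift : ∀ {m n} (a : Fin (suc m)) (xs : Vec (Fin m) n) →
                    longestChain r (valueWord xs) ≤ longestChain r (valueWord (Vec.map (punchIn a) xs))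
    measure-shift a xs = begin
      longestChain r (map value (toList xs))
        ≤⟨ longestChain-relabel-≤ r value (value ∘ punchIn a)
             (r-respects value (value ∘ punchIn a) (value-punchIn-<⇔ a)) (toList xs) ⟩
      longestChain r (map (value ∘ punchIn a) (toList xs))
        ≡⟨ cong (longestChain r) (trans (cong (map value) (Vec.toList-map (punchIn a) xs)) (sym (List.map-∘ (toList xs)))) ⟨
      longestChain r (valueWord (Vec.map (punchIn a) xs))
        ∎
      where open ℕ.≤-Reasoning

  module ChainSteps (r : ℤ → ℤ → Bool) (r-respects : RespectsOrder r) (l : ℤ) where

    open Steps involutionClasses (chainStatistic r r-respects) l

    Pr-suc-k : ∀ k m → Pr (2 * suc k + m) (λ _ → m) ≤ℚ Pr (2 * k + m) (λ _ → m)
    Pr-suc-k k m = subst (λ n → Pr n (λ _ → m) ≤ℚ Pr (2 * k + m) (λ _ → m))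
      (sym (cong (_+ m) (ℕ.*-suc 2 k)))
      (cycle-step (2 * k + m) (λ _ → m) (suc (2 * k))
        (trans (cong (_+ suc (suc (2 * k))) (+-identityʳ m)) (+-comm m (suc (suc (2 * k))))))

    Pr-suc-m : ∀ k m → Pr (2 * k + suc m) (λ _ → suc m) ≤ℚ Pr (2 * k + m) (λ _ → m)
    Pr-suc-m k m = subst (λ n → Pr n (λ _ → suc m) ≤ℚ Pr (2 * k + m) (λ _ → m))
      (sym (ℕ.+-suc (2 * k) m))
      (fixedPoint-step (2 * k + m) (λ _ → m) (λ _ → suc m) tt (λ _ → refl))

module Signed where

  SignedPoint : ℕ → Set
  SignedPoint n = Bool × Fin n

  bools-enumerate : Enumerates Bool._≟_ (false ∷ true ∷ [])
  bools-enumerate .occurs-once false = refl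
  bools-enumerate .occurs-once true  = refl

  signedPoints : PointLabelling
  signedPoints = record
    { Label                = Bool
    ; _≟ᴸ_                 = Bool._≟_
    ; labels               = false ∷ true ∷ []
    ; labels-enumerate     = bools-enumerate
    ; Point                = SignedPoint
    ; _≟ₚ_                 = Product.≡-dec Bool._≟_ Fin._≟_
    ; points               = λ n → cartesianProduct (false ∷ true ∷ []) (allFin n)
    ; points-enumerate     = λ n → cartesianProduct-enumerates bools-enumerate (allFin-enumerates n)
    ; point                = _,_
    ; label                = proj₁
    ; position             = proj₂
    ; label-point          = λ _ _ → refl
    ; position-point       = λ _ _ → refl
    ; point-label-position = λ _ → refl
    }

  open PointLabelling signedPoints using (_≟ₚ_)
  open Involutions signedPoints using (IsInvolution; fixedCount; shift; ClassTest; Statistic; module Steps)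

  flip : SignedPoint n → SignedPoint n
  flip p = not (proj₁ p) , proj₂ p

  flip-involutive : (p : SignedPoint n) → flip (flip p) ≡ p
  flip-involutive p = cong (_, proj₂ p) (not-involutive (proj₁ p))

  flip-injective : {p q : SignedPoint n} → flip p ≡ flip q → p ≡ q
  flip-injective {p = p} {q} eq = trans (sym (flip-involutive p)) (trans (cong flip eq) (flip-involutive q))

  𝟙-flip : (p q : SignedPoint n) → 𝟙 (flip p ≟ₚ flip q) ≡ 𝟙 (p ≟ₚ q)
  𝟙-flip p q = 𝟙-cong (flip p ≟ₚ flip q) (p ≟ₚ q) flip-injective (cong flip)

  sval-flip : (p : SignedPoint n) → sval (flip p) ≡ ℤ.- sval p
  sval-flip (false , i) = refl
  sval-flip (true  , i) = refl

  sval-injective : {p q : SignedPoint n} → sval p ≡ sval q → p ≡ q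
  sval-injective {p = false , i} {false , j} eq = cong (false ,_) (toℕ-injective (ℕ.suc-injective (ℤ.+-injective eq)))
  sval-injective {p = true  , i} {true  , j} eq = cong (true ,_) (toℕ-injective (ℤ.-[1+-injective eq))
  sval-injective {p = false , i} {true  , j} ()
  sval-injective {p = true  , i} {false , j} ()

  mirror : List (SignedPoint n) → List (SignedPoint n)
  mirror ps = reverse (map flip ps) ++ ps

  mirror-⊆ : {ps qs : List (SignedPoint n)} → ps ⊆ qs → mirror ps ⊆ mirror qs
  mirror-⊆ ps⊆qs = ++⁺ (reverse⁺ (map⁺ flip ps⊆qs)) ps⊆qs

  map-mirror : (f : SignedPoint m → SignedPoint n) → (∀ p → f (flip p) ≡ flip (f p)) →
               (ps : List (SignedPoint m)) → map f (mirror ps) ≡ mirror (map f ps)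
  map-mirror f f-flip ps = begin
    map f (reverse (map flip ps) ++ ps)             ≡⟨ List.map-++ f (reverse (map flip ps)) ps ⟩
    map f (reverse (map flip ps)) ++ map f ps  ≡⟨ cong (_++ map f ps) (List.reverse-map f (map flip ps)) ⟩
    reverse (map f (map flip ps)) ++ map f ps  ≡⟨ cong (λ qs → reverse qs ++ map f ps) commute ⟩
    reverse (map flip (map f ps)) ++ map f ps  ∎
    where
    open ≡-Reasoning
    commute : map f (map flip ps) ≡ map flip (map f ps)
    commute = trans (sym (List.map-∘ ps)) (trans (List.map-cong f-flip ps) (List.map-∘ ps))

  ∑-mirror : (ps : List (SignedPoint n)) (g : SignedPoint n → ℕ) → ∑ (mirror ps) g ≡ ∑ ps (g ∘ flip) + ∑ ps g
  ∑-mirror ps g = trans (∑-++ (reverse (map flip ps)) ps g)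
    (cong (_+ ∑ ps g) (trans (∑-reverse (map flip ps) g) (∑-map flip ps g)))

  -- As π (-x) = - π x, the word π(-N),…,π(-1),π(1),…,π(N) is determined by its positive half.
  signedWord : Vec (SignedPoint m) n → List ℤ
  signedWord xs = map sval (mirror (toList xs))

  sval-punchIn-<⇔ : (a : Fin (suc m)) (p q : SignedPoint m) →
                    sval p ℤ.< sval q ⇔ sval (shift (punchIn a) p) ℤ.< sval (shift (punchIn a) q)
  sval-punchIn-<⇔ a (false , x) (false , y) = value-punchIn-<⇔ a x y
  sval-punchIn-<⇔ a (true  , x) (true  , y) = mk⇔
    (λ { (ℤ.-<- y<x) → ℤ.-<- (Equivalence.to (punchIn-<⇔ a) y<x) })
    (λ { (ℤ.-<- y<x) → ℤ.-<- (Equivalence.from (punchIn-<⇔ a) y<x) })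
  sval-punchIn-<⇔ a (false , x) (true  , y) = mk⇔ (λ ()) (λ ())
  sval-punchIn-<⇔ a (true  , x) (false , y) = mk⇔ (λ _ → ℤ.-<+) (λ _ → ℤ.-<+)

  signedWord-shift : (f : Fin m → Fin n) (xs : Vec (SignedPoint m) k) →
                     signedWord (Vec.map (shift f) xs) ≡ map (sval ∘ shift f) (mirror (toList xs))
  signedWord-shift f xs = begin
    map sval (mirror (toList (Vec.map (shift f) xs)))       ≡⟨ cong (map sval ∘ mirror) (Vec.toList-map (shift f) xs) ⟩
    map sval (mirror (map (shift f) (toList xs)))      ≡⟨ cong (map sval) (map-mirror (shift f) (λ _ → refl) (toList xs)) ⟨
    map sval (map (shift f) (mirror (toList xs)))      ≡⟨ List.map-∘ (mirror (toList xs)) ⟨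
    map (sval ∘ shift f) (mirror (toList xs))               ∎
    where open ≡-Reasoning

  signedChainStatistic : (r : ℤ → ℤ → Bool) → RespectsOrder r → Statistic
  signedChainStatistic r r-respects = record
    { measure          = λ xs → longestChain r (signedWord xs)
    ; measure-insertAt = λ xs i x → longestChain-mono-⊆ r (map⁺ sval (mirror-⊆ (toList-⊆-insertAt xs i x)))
    ; measure-shift    = measure-shift
    }
    where
    measure-shift : ∀ {m n} (a : Fin (suc m)) (xs : Vec (SignedPoint m) n) →
                    longestChain r (signedWord xs) ≤ longestChain r (signedWord (Vec.map (shift (punchIn a)) xs))
    measure-shift a xs = begin
      longestChain r (map sval (mirror (toList xs)))
        ≤⟨ longestChain-relabel-≤ r sval (sval ∘ shift (punchIn a))
             (r-respects sval (sval ∘ shift (punchIn a)) (sval-punchIn-<⇔ a)) (mirror (toList xs)) ⟩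
      longestChain r (map (sval ∘ shift (punchIn a)) (mirror (toList xs)))
        ≡⟨ cong (longestChain r) (signedWord-shift (punchIn a) xs) ⟨
      longestChain r (signedWord (Vec.map (shift (punchIn a)) xs))
        ∎
      where open ℕ.≤-Reasoning

  -- act v (s , i) is π (±(i+1)), the sign being - iff s = true, for the involution π stored in v.
  act : Vec (SignedPoint n) n → SignedPoint n → SignedPoint n
  act v (false , i) = lookup v i
  act v (true  , i) = flip (lookup v i)

  act-flip : (v : Vec (SignedPoint n) n) (p : SignedPoint n) → act v (flip p) ≡ flip (act v p)
  act-flip v (false , i) = refl
  act-flip v (true  , i) = sym (flip-involutive (lookup v i))

  applyS-sval : (v : Vec (SignedPoint n) n) (p : SignedPoint n) → applyS v (sval p) ≡ sval (act v p)
  applyS-sval {n} v (false , i) with toℕ i ℕ.<? n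
  ... | yes i<n = cong (sval ∘ lookup v) (fromℕ<-toℕ i i<n)
  ... | no  i≮n = contradiction (toℕ<n i) i≮n
  applyS-sval v (true , i) = trans (cong ℤ.-_ (applyS-sval v (false , i))) (sym (sval-flip (lookup v i)))

  upTo≡map-toℕ : ∀ n → upTo n ≡ map toℕ (allFin n)
  upTo≡map-toℕ n = trans (applyUpTo≡tabulate n) (sym (List.map-tabulate {n = n} (λ i → i) toℕ))
    where
    applyUpTo≡tabulate : ∀ {f : ℕ → ℕ} n → applyUpTo f n ≡ tabulate {n = n} (f ∘ toℕ)
    applyUpTo≡tabulate ℕ.zero        = refl
    applyUpTo≡tabulate {f} (suc n)   = cong (f 0 ∷_) (applyUpTo≡tabulate n)

  domainPoints : ∀ n → List (SignedPoint n)
  domainPoints n = mirror (map (false ,_) (allFin n))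

  domain≡ : ∀ n → domain n ≡ map sval (domainPoints n)
  domain≡ n = begin
    List.map -[1+_] (reverse (upTo n)) ++ map +[1+_] (upTo n)
      ≡⟨ cong (_++ map +[1+_] (upTo n)) (List.reverse-map -[1+_] (upTo n)) ⟩
    reverse (List.map -[1+_] (upTo n)) ++ map +[1+_] (upTo n)
      ≡⟨ cong (λ ks → reverse (List.map -[1+_] ks) ++ map +[1+_] ks) (upTo≡map-toℕ n) ⟩
    reverse (List.map -[1+_] (map toℕ fins)) ++ map +[1+_] (map toℕ fins)
      ≡⟨ cong₂ (λ xs ys → reverse xs ++ ys) (List.map-∘ fins) (List.map-∘ fins) ⟨
    reverse (map (sval ∘ flip ∘ (false ,_)) fins) ++ map (sval ∘ (false ,_)) fins
      ≡⟨ cong₂ (λ xs ys → reverse xs ++ ys)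
           (trans (List.map-∘ fins) (cong (map sval) (List.map-∘ fins))) (List.map-∘ fins) ⟩
    reverse (map sval (map flip ps)) ++ map sval ps
      ≡⟨ cong (_++ map sval ps) (List.reverse-map sval (map flip ps)) ⟨
    map sval (reverse (map flip ps)) ++ map sval ps
      ≡⟨ List.map-++ sval (reverse (map flip ps)) ps ⟨
    map sval (domainPoints n)
      ∎
    where
    open ≡-Reasoning
    fins  = allFin n
    ps = map (false ,_) fins

  ∈-domainPoints : (p : SignedPoint n) → p ∈ domainPoints n
  ∈-domainPoints {n} (false , i) = ∈-++⁺ʳ (reverse (map flip (map (false ,_) (allFin n)))) (∈-map⁺ (false ,_) (∈-allFin i))
  ∈-domainPoints     (true  , i) = ∈-++⁺ˡ (Any.reverse⁺ (∈-map⁺ flip (∈-map⁺ (false ,_) (∈-allFin i))))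

  wordS≡signedWord : (v : Vec (SignedPoint n) n) → wordS v ≡ signedWord v
  wordS≡signedWord {n} v = begin
    map (applyS v) (domain n)            ≡⟨ cong (map (applyS v)) (domain≡ n) ⟩
    map (applyS v) (map sval D)          ≡⟨ List.map-∘ D ⟨
    map (applyS v ∘ sval) D              ≡⟨ List.map-cong (applyS-sval v) D ⟩
    map (sval ∘ act v) D                 ≡⟨ List.map-∘ D ⟩
    map sval (map (act v) D)             ≡⟨ cong (map sval) (map-mirror (act v) (act-flip v) ps) ⟩
    map sval (mirror (map (act v) ps))   ≡⟨ cong (map sval ∘ mirror) (trans (toList≡map-lookup v) (List.map-∘ (allFin n))) ⟨
    signedWord v                         ∎
    where
    open ≡-Reasoning
    D  = domainPoints n
    ps = map (false ,_) (allFin n)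

  ∑-act-domainPoints : (v : Vec (SignedPoint n) n) (g : SignedPoint n → SignedPoint n) →
                       (∀ p → g (flip p) ≡ flip (g p)) →
                       ∑[ p ∈ domainPoints n ] 𝟙 (act v p ≟ₚ g p) ≡
                       ∑[ i ∈ allFin n ] 𝟙 (lookup v i ≟ₚ g (false , i)) + ∑[ i ∈ allFin n ] 𝟙 (lookup v i ≟ₚ g (false , i))
  ∑-act-domainPoints {n} v g g-flip = begin
    ∑[ p ∈ mirror ps ] 𝟙 (act v p ≟ₚ g p)
      ≡⟨ ∑-mirror ps _ ⟩
    ∑[ p ∈ ps ] 𝟙 (act v (flip p) ≟ₚ g (flip p)) + ∑[ p ∈ ps ] 𝟙 (act v p ≟ₚ g p)
      ≡⟨ cong (_+ ∑[ p ∈ ps ] 𝟙 (act v p ≟ₚ g p)) (∑-cong ps (λ p →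
           trans (cong₂ (λ x y → 𝟙 (x ≟ₚ y)) (act-flip v p) (g-flip p)) (𝟙-flip (act v p) (g p)))) ⟩
    ∑[ p ∈ ps ] 𝟙 (act v p ≟ₚ g p) + ∑[ p ∈ ps ] 𝟙 (act v p ≟ₚ g p)
      ≡⟨ cong₂ _+_ (∑-map (false ,_) (allFin n) count) (∑-map (false ,_) (allFin n) count) ⟩
    ∑[ i ∈ allFin n ] 𝟙 (lookup v i ≟ₚ g (false , i)) + ∑[ i ∈ allFin n ] 𝟙 (lookup v i ≟ₚ g (false , i))
      ∎
    where
    open ≡-Reasoning
    ps = map (false ,_) (allFin n)
    count : SignedPoint n → ℕ
    count p = 𝟙 (act v p ≟ₚ g p)

  countᵇ-applyS-domain : (v : Vec (SignedPoint n) n) (f : ℤ → ℤ) (g : SignedPoint n → SignedPoint n) →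
                         (∀ p → f (sval p) ≡ sval (g p)) → (∀ p → g (flip p) ≡ flip (g p)) →
                         countᵇ (λ x → applyS v x ==ℤ f x) (domain n) ≡
                         ∑[ i ∈ allFin n ] 𝟙 (lookup v i ≟ₚ g (false , i)) + ∑[ i ∈ allFin n ] 𝟙 (lookup v i ≟ₚ g (false , i))
  countᵇ-applyS-domain {n} v f g f-sval g-flip = begin
    countᵇ (λ x → applyS v x ==ℤ f x) (domain n)
      ≡⟨ countᵇ≡∑ _ (domain n) ⟩
    ∑[ x ∈ domain n ] ⟦ applyS v x ==ℤ f x ⟧
      ≡⟨ cong (λ xs → ∑[ x ∈ xs ] ⟦ applyS v x ==ℤ f x ⟧) (domain≡ n) ⟩
    ∑[ x ∈ map sval (domainPoints n) ] ⟦ applyS v x ==ℤ f x ⟧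
      ≡⟨ ∑-map sval (domainPoints n) _ ⟩
    ∑[ p ∈ domainPoints n ] ⟦ applyS v (sval p) ==ℤ f (sval p) ⟧
      ≡⟨ ∑-cong (domainPoints n) (λ p → 𝟙-cong (applyS v (sval p) ℤ.≟ f (sval p)) (act v p ≟ₚ g p)
           (λ eq → sval-injective (trans (sym (applyS-sval v p)) (trans eq (f-sval p))))
           (λ eq → trans (applyS-sval v p) (trans (cong sval eq) (sym (f-sval p))))) ⟩
    ∑[ p ∈ domainPoints n ] 𝟙 (act v p ≟ₚ g p)
      ≡⟨ ∑-act-domainPoints v g g-flip ⟩
    ∑[ i ∈ allFin n ] 𝟙 (lookup v i ≟ₚ g (false , i)) + ∑[ i ∈ allFin n ] 𝟙 (lookup v i ≟ₚ g (false , i))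
      ∎
    where open ≡-Reasoning

  numFixedS≡ : (v : Vec (SignedPoint n) n) → numFixedS v ≡ fixedCount v false + fixedCount v false
  numFixedS≡ v = countᵇ-applyS-domain v (λ x → x) (λ p → p) (λ _ → refl) (λ _ → refl)

  numNegS≡ : (v : Vec (SignedPoint n) n) → numNegS v ≡ fixedCount v true + fixedCount v true
  numNegS≡ v = countᵇ-applyS-domain v ℤ.-_ flip (λ p → sym (sval-flip p)) (λ _ → refl)

  act-involutive-at⇔ : (v : Vec (SignedPoint n) n) (i : Fin n) →
                       act v (lookup v i) ≡ (false , i) ⇔ lookup v (proj₂ (lookup v i)) ≡ (proj₁ (lookup v i) , i)
  act-involutive-at⇔ v i with lookup v i
  ... | false , j = mk⇔ (λ eq → eq) (λ eq → eq)
  ... | true  , j = mk⇔ flip-injective (cong flip)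

  act-involutive⇔ : (v : Vec (SignedPoint n) n) → (∀ p → act v (act v p) ≡ p) ⇔ IsInvolution v
  act-involutive⇔ v = mk⇔ (λ inv i → Equivalence.to (act-involutive-at⇔ v i) (inv (false , i))) from
    where
    from : IsInvolution v → ∀ p → act v (act v p) ≡ p
    from inv (false , i) = Equivalence.from (act-involutive-at⇔ v i) (inv i)
    from inv (true  , i) = trans (act-flip v (lookup v i)) (cong flip (from inv (false , i)))

  isSignedInvolution⇔ : (v : Vec (SignedPoint n) n) → T (isSignedInvolution v) ⇔ IsInvolution v
  isSignedInvolution⇔ {n} v = mk⇔
    (λ h → Equivalence.to (act-involutive⇔ v) (λ p → sval-injective (trans (sym (applyS²-sval p))
      (toWitness (T-allᵇ⁻ (involutiveAt ∘ sval) (domainPoints n) (subst T on-points h) (∈-domainPoints p))))))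
    (λ inv → subst T (sym on-points) (T-allᵇ⁺ (involutiveAt ∘ sval) (domainPoints n) (λ {p} _ →
      fromWitness (trans (applyS²-sval p) (cong sval (Equivalence.from (act-involutive⇔ v) inv p))))))
    where
    involutiveAt : ℤ → Bool
    involutiveAt x = applyS v (applyS v x) ==ℤ x
    on-points : isSignedInvolution v ≡ allᵇ (involutiveAt ∘ sval) (domainPoints n)
    on-points = trans (cong (allᵇ involutiveAt) (domain≡ n)) (allᵇ-map involutiveAt sval (domainPoints n))
    applyS²-sval : ∀ p → applyS v (applyS v (sval p)) ≡ sval (act v (act v p))
    applyS²-sval p = trans (cong (applyS v) (applyS-sval v p)) (applyS-sval v (act v p))

  signCounts : ℕ → ℕ → Bool → ℕ
  signCounts m₊ m₋ false = m₊
  signCounts m₊ m₋ true  = m₋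

  signedInvolutionClasses : ClassTest
  signedInvolutionClasses = record
    { inClass          = λ m v → isSignedInvolution v ∧ (numFixedS v ℕ.≡ᵇ 2 * m false) ∧ (numNegS v ℕ.≡ᵇ 2 * m true)
    ; inClass-sound    = λ {_} {m} {v} → sound m v
    ; inClass-complete = λ {_} {m} {v} → complete m v
    }
    where
    half : ∀ {x y} → x + x ≡ 2 * y → x ≡ y
    half {x} {y} eq = ℕ.*-cancelˡ-≡ x y 2 (trans (cong (x +_) (ℕ.+-identityʳ x)) eq)

    double : ∀ {x y} → x ≡ y → x + x ≡ 2 * y
    double {x} refl = cong (x +_) (sym (ℕ.+-identityʳ x))

    sound : ∀ m (v : Vec (SignedPoint n) n) →
            T (isSignedInvolution v ∧ (numFixedS v ℕ.≡ᵇ 2 * m false) ∧ (numNegS v ℕ.≡ᵇ 2 * m true)) →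
            IsInvolution v × (∀ t → fixedCount v t ≡ m t)
    sound m v h with Equivalence.to T-∧ h
    ... | inv , counts with Equivalence.to T-∧ counts
    ...   | fixed , negated = Equivalence.to (isSignedInvolution⇔ v) inv , fix
      where
      fix : ∀ t → fixedCount v t ≡ m t
      fix false = half (trans (sym (numFixedS≡ v)) (ℕ.≡ᵇ⇒≡ _ _ fixed))
      fix true  = half (trans (sym (numNegS≡ v)) (ℕ.≡ᵇ⇒≡ _ _ negated))

    complete : ∀ m (v : Vec (SignedPoint n) n) → IsInvolution v → (∀ t → fixedCount v t ≡ m t) →
               T (isSignedInvolution v ∧ (numFixedS v ℕ.≡ᵇ 2 * m false) ∧ (numNegS v ℕ.≡ᵇ 2 * m true))
    complete m v inv fix = Equivalence.from T-∧ (Equivalence.from (isSignedInvolution⇔ v) inv ,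
      Equivalence.from T-∧ (ℕ.≡⇒≡ᵇ _ _ (trans (numFixedS≡ v) (double (fix false))) ,
                            ℕ.≡⇒≡ᵇ _ _ (trans (numNegS≡ v) (double (fix true)))))

  module SignedSteps (l : ℤ) where

    open Steps signedInvolutionClasses (signedChainStatistic _<ᵇ_ <ᵇ-respectsOrder) l

    Pr± : ℕ → ℕ → ℕ → ℚ
    Pr± k m₊ m₋ = Pr (sizeS k m₊ m₋) (signCounts m₊ m₋)

    PrSigned≡Pr± : ∀ k m₊ m₋ → PrSigned k m₊ m₋ l ≡ Pr± k m₊ m₋
    PrSigned≡Pr± k m₊ m₋ = prob-cong _ _ (S± k m₊ m₋) (λ v → cong (λ w → ⌊ ℤ.+ LIS w ℤ.≤? l ⌋) (wordS≡signedWord v))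

    Pr±-suc-k : ∀ k m₊ m₋ → Pr± (suc k) m₊ m₋ ≤ℚ Pr± k m₊ m₋
    Pr±-suc-k k m₊ m₋ = subst (λ n → Pr n (signCounts m₊ m₋) ≤ℚ Pr± k m₊ m₋)
      (sym (cong (λ x → x + m₊ + m₋) (ℕ.*-suc 2 k)))
      (cycle-step (sizeS k m₊ m₋) (signCounts m₊ m₋) (suc (2 * k)) size)
      where
      open ≡-Reasoning
      size : m₊ + (m₋ + 0) + suc (suc (2 * k)) ≡ suc (suc (sizeS k m₊ m₋))
      size = begin
        m₊ + (m₋ + 0) + suc (suc (2 * k))    ≡⟨ cong (λ x → m₊ + x + suc (suc (2 * k))) (+-identityʳ m₋) ⟩
        m₊ + m₋ + suc (suc (2 * k))          ≡⟨ +-comm (m₊ + m₋) (suc (suc (2 * k))) ⟩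
        suc (suc (2 * k + (m₊ + m₋)))        ≡⟨ cong (λ x → suc (suc x)) (+-assoc (2 * k) m₊ m₋) ⟨
        suc (suc (sizeS k m₊ m₋))            ∎

    Pr±-suc-m₊ : ∀ k m₊ m₋ → Pr± k (suc m₊) m₋ ≤ℚ Pr± k m₊ m₋
    Pr±-suc-m₊ k m₊ m₋ = subst (λ n → Pr n (signCounts (suc m₊) m₋) ≤ℚ Pr± k m₊ m₋)
      (sym (cong (_+ m₋) (ℕ.+-suc (2 * k) m₊)))
      (fixedPoint-step (sizeS k m₊ m₋) (signCounts m₊ m₋) (signCounts (suc m₊) m₋) false λ { false → refl ; true → refl })

    Pr±-suc-m₋ : ∀ k m₊ m₋ → Pr± k m₊ (suc m₋) ≤ℚ Pr± k m₊ m₋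
    Pr±-suc-m₋ k m₊ m₋ = subst (λ n → Pr n (signCounts m₊ (suc m₋)) ≤ℚ Pr± k m₊ m₋)
      (sym (ℕ.+-suc (2 * k + m₊) m₋))
      (fixedPoint-step (sizeS k m₊ m₋) (signCounts m₊ m₋) (signCounts m₊ (suc m₋)) true λ { false → refl ; true → refl })

    PrSigned-suc-k : ∀ k m₊ m₋ → PrSigned (suc k) m₊ m₋ l ≤ℚ PrSigned k m₊ m₋ l
    PrSigned-suc-k k m₊ m₋ =
      subst₂ _≤ℚ_ (sym (PrSigned≡Pr± (suc k) m₊ m₋)) (sym (PrSigned≡Pr± k m₊ m₋)) (Pr±-suc-k k m₊ m₋)

    PrSigned-suc-m₊ : ∀ k m₊ m₋ → PrSigned k (suc m₊) m₋ l ≤ℚ PrSigned k m₊ m₋ l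
    PrSigned-suc-m₊ k m₊ m₋ =
      subst₂ _≤ℚ_ (sym (PrSigned≡Pr± k (suc m₊) m₋)) (sym (PrSigned≡Pr± k m₊ m₋)) (Pr±-suc-m₊ k m₊ m₋)

    PrSigned-suc-m₋ : ∀ k m₊ m₋ → PrSigned k m₊ (suc m₋) l ≤ℚ PrSigned k m₊ m₋ l
    PrSigned-suc-m₋ k m₊ m₋ =
      subst₂ _≤ℚ_ (sym (PrSigned≡Pr± k m₊ (suc m₋))) (sym (PrSigned≡Pr± k m₊ m₋)) (Pr±-suc-m₋ k m₊ m₋)

steps⇒antitone : (f : ℕ → ℚ) → (∀ j → f (suc j) ≤ℚ f j) → ∀ k k′ → k ≤ k′ → f k′ ≤ℚ f k
steps⇒antitone f step k k′ k≤k′ = go (ℕ.≤⇒≤′ k≤k′)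
  where
  go : ∀ {k′} → k ≤′ k′ → f k′ ≤ℚ f k
  go ≤′-refl          = ℚ.≤-refl
  go (≤′-step k≤′k′)  = ℚ.≤-trans (step _) (go k≤′k′)

lemma7p5 : (l : ℤ) →
    ((k k′ m : ℕ) → k ≤ k′ → PrInc k′ m l ≤ℚ PrInc k m l) ×
    ((k m m′ : ℕ) → m ≤ m′ → PrInc k m′ l ≤ℚ PrInc k m l) ×
    ((k k′ m : ℕ) → k ≤ k′ → PrDec k′ m l ≤ℚ PrDec k m l) ×
    ((k m m′ : ℕ) → m ≤ m′ → PrDec k m′ l ≤ℚ PrDec k m l) ×
    ((k k′ m₊ m₋ : ℕ) → k ≤ k′ → PrSigned k′ m₊ m₋ l ≤ℚ PrSigned k m₊ m₋ l) ×
    ((k m₊ m₊′ m₋ : ℕ) → m₊ ≤ m₊′ → PrSigned k m₊′ m₋ l ≤ℚ PrSigned k m₊ m₋ l) ×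
    ((k m₊ m₋ m₋′ : ℕ) → m₋ ≤ m₋′ → PrSigned k m₊ m₋′ l ≤ℚ PrSigned k m₊ m₋ l)
lemma7p5 l =
  (λ k k′ m      → steps⇒antitone (λ j → PrInc j m l)        (λ j → Increasing.Pr-suc-k j m)               k k′) ,
  (λ k m m′      → steps⇒antitone (λ j → PrInc k j l)        (λ j → Increasing.Pr-suc-m k j)               m m′) ,
  (λ k k′ m      → steps⇒antitone (λ j → PrDec j m l)        (λ j → Decreasing.Pr-suc-k j m)               k k′) ,
  (λ k m m′      → steps⇒antitone (λ j → PrDec k j l)        (λ j → Decreasing.Pr-suc-m k j)               m m′) ,
  (λ k k′ m₊ m₋  → steps⇒antitone (λ j → PrSigned j m₊ m₋ l) (λ j → SignedIncreasing.PrSigned-suc-k j m₊ m₋)  k k′) ,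
  (λ k m₊ m₊′ m₋ → steps⇒antitone (λ j → PrSigned k j m₋ l)  (λ j → SignedIncreasing.PrSigned-suc-m₊ k j m₋) m₊ m₊′) ,
  (λ k m₊ m₋ m₋′ → steps⇒antitone (λ j → PrSigned k m₊ j l)  (λ j → SignedIncreasing.PrSigned-suc-m₋ k m₊ j) m₋ m₋′)
  where
  module Increasing       = Unsigned.ChainSteps _<ᵇ_ <ᵇ-respectsOrder l
  module Decreasing       = Unsigned.ChainSteps _>ᵇ_ >ᵇ-respectsOrder l
  module SignedIncreasing = Signed.SignedSteps l
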